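{- Let $k\geq 0$ and $n=k+2$. If $n$ is even, then $\Theta_e(n)$ and $\Lambda_e(n)$ belong to the clean compact peg basis of $\hat B_k^{(prd)}$; if $n$ is odd, then $\Theta_o(n)$ and $\Lambda_o(n)$ belong to the clean compact peg basis of $\hat B_k^{(prd)}$. Moreover each of these peg permutations $\pi^\varepsilon$ satisfies $prd(\pi^\varepsilon)=n$.
   Context: A peg permutation of length $n$ is a word $\pi_1^{\varepsilon_1}\cdots\pi_n^{\varepsilon_n}$ where $\pi_1\cdots\pi_n$ is a permutation of $\{1,\dots,n\}$ in one-line notation and each $\varepsilon_i\in\{+,-,\bullet\}$. An increasing (resp. decreasing) strip is a maximal factor of consecutive positions in which each value is one more (resp. one less) than the previous and all entries are decorated $+$ or $\bullet$ (resp. $-$ or $\bullet$); a peg permutation is clean compact if all strips have length $1$. An identity peg permutation has identity underlying permutation and decorations in $\{+,\bullet\}$. A prefix reversal of a peg permutation reverses a prefix and swaps $+\leftrightarrow-$ on the reversed entries ($\bullet$ unchanged); $prd(\pi^\varepsilon)$ is the minimum number of prefix reversals turning $\pi^\varepsilon$ into an identity peg permutation of the same length; $\hat B_k^{(prd)}$ is the set of peg permutations with $prd\le k$. Peg pattern order: $\sigma^\delta$ of length $m$ is a pattern of $\tau^\varepsilon$ if there are $i_1<\dots<i_m$ with $\tau_{i_1}\cdots\tau_{i_m}$ order-isomorphic to $\sigma$ and, for each $j$, $\delta_j\in\{+,-\}$ implies $\varepsilon_{i_j}=\delta_j$. The clean compact peg basis of a pattern-closed set $X$ is the set of clean compact peg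 permutations not in $X$ all of whose proper clean compact patterns lie in $X$. Exceptional permutations (all decorations $\bullet$ except the one indicated): for $n$ even, $\Theta_e(n)=n^\bullet(n-2)^\bullet\cdots4^\bullet2^\bullet\,1^+\,3^\bullet5^\bullet\cdots(n-1)^\bullet$ (even values decreasing, then $1$, then odd values $\ge3$ increasing), and with $t=n/2$, $\Lambda_e(n)=(t+1)^+\,t^\bullet\,(t+2)^\bullet(t-1)^\bullet\cdots n^\bullet 1^\bullet$, i.e. the entries at positions $2j-1,2j$ are $t+j,\,t+1-j$ for $j=1,\dots,t$, with only the first decorated $+$. For $n$ odd, $\Theta_o(n)=n^\bullet(n-2)^\bullet\cdots3^\bullet\,1^-\,2^\bullet4^\bullet\cdots(n-1)^\bullet$ (odd values decreasing down to $1$, then even values increasing), and with $t=(n+1)/2$, $\Lambda_o(n)=t^-\,(t+1)^\bullet(t-1)^\bullet(t+2)^\bullet(t-2)^\bullet\cdots n^\bullet1^\bullet$, i.e. first $t$ then the pairs $t+j,\,t-j$ for $j=1,\dots,(n-1)/2$, with only the first entry decorated $-$. -}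

module Defs where

open import Data.Nat using (ℕ; zero; suc; _+_; _*_; _∸_; _≤_; _<_; ⌊_/2⌋)
open import Data.Fin as Fin using (Fin)
open import Data.List using (List; []; _∷_; length; map; reverse; take; drop; _++_; applyUpTo; concat; lookup)
open import Data.List.Relation.Binary.Permutation.Propositional using (_↭_)
open import Data.List.Relation.Unary.All using (All)
open import Data.Product using (Σ; _×_; _,_; proj₁; proj₂)
open import Data.Sum using (_⊎_)
open import Relation.Binary.PropositionalEquality using (_≡_; _≢_)
open import Relation.Nullary using (¬_)

data Deco : Set where
  plus minus dot : Deco

-- A word π₁^ε₁ ⋯ πₙ^εₙ : list of (value , decoration); values are 1..n.
Word : Set
Word = List (ℕ × Deco)

values : Word → List ℕ
values = map proj₁

IsPegPerm : Word → Set
IsPegPerm w = values w ↭ applyUpTo suc (length w)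

PlusOrDot : Deco → Set
PlusOrDot d = (d ≡ plus) ⊎ (d ≡ dot)

MinusOrDot : Deco → Set
MinusOrDot d = (d ≡ minus) ⊎ (d ≡ dot)

IsIdentity : Word → Set
IsIdentity w = (values w ≡ applyUpTo suc (length w)) × All (λ e → PlusOrDot (proj₂ e)) w

-- two adjacent entries lying in a common increasing / decreasing strip
IncAdj : ℕ × Deco → ℕ × Deco → Set
IncAdj (a , d) (b , e) = (b ≡ suc a) × PlusOrDot d × PlusOrDot e

DecAdj : ℕ × Deco → ℕ × Deco → Set
DecAdj (a , d) (b , e) = (a ≡ suc b) × MinusOrDot d × MinusOrDot e

-- clean compact: every strip has length 1, i.e. no two consecutive
-- positions belong to a common (increasing or decreasing) strip
CleanCompact : Word → Set
CleanCompact [] = ⊤′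
  where open import Data.Unit using () renaming (⊤ to ⊤′)
CleanCompact (x ∷ []) = ⊤′
  where open import Data.Unit using () renaming (⊤ to ⊤′)
CleanCompact (x ∷ y ∷ r) = ¬ IncAdj x y × ¬ DecAdj x y × CleanCompact (y ∷ r)

flipDeco : Deco → Deco
flipDeco plus = minus
flipDeco minus = plus
flipDeco dot = dot

flipEntry : ℕ × Deco → ℕ × Deco
flipEntry (a , d) = (a , flipDeco d)

prefixRev : ℕ → Word → Word
prefixRev i w = map flipEntry (reverse (take i w)) ++ drop i w

data SortableWithin : ℕ → Word → Set where
  done : ∀ {m w} → IsIdentity w → SortableWithin m w
  step : ∀ {m w} (i : ℕ) → 1 ≤ i → i ≤ length w →
         SortableWithin m (prefixRev i w) → SortableWithin (suc m) w

PrdIs : Word → ℕ → Set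
PrdIs w d = SortableWithin d w × (∀ m → m < d → ¬ SortableWithin m w)

Bhat : ℕ → Word → Set
Bhat k w = IsPegPerm w × SortableWithin k w

DecoCompat : Deco → Deco → Set
DecoCompat plus e = e ≡ plus
DecoCompat minus e = e ≡ minus
DecoCompat dot e = ⊤′
  where open import Data.Unit using () renaming (⊤ to ⊤′)

IsPattern : Word → Word → Set
IsPattern σ τ =
  Σ (Fin (length σ) → Fin (length τ)) λ f →
    (∀ i j → i Fin.< j → f i Fin.< f j) ×
    (∀ i j → (proj₁ (lookup σ i) < proj₁ (lookup σ j) → proj₁ (lookup τ (f i)) < proj₁ (lookup τ (f j)))
           × (proj₁ (lookup τ (f i)) < proj₁ (lookup τ (f j)) → proj₁ (lookup σ i) < proj₁ (lookup σ j))) ×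
    (∀ i → DecoCompat (proj₂ (lookup σ i)) (proj₂ (lookup τ (f i))))

InCleanCompactBasis : (Word → Set) → Word → Set
InCleanCompactBasis X w =
  IsPegPerm w × CleanCompact w × ¬ X w ×
  (∀ σ → IsPegPerm σ → CleanCompact σ → IsPattern σ w → σ ≢ w → X σ)

allDot : List ℕ → Word
allDot = map (λ v → (v , dot))

setHeadDeco : Deco → Word → Word
setHeadDeco d [] = []
setHeadDeco d ((v , _) ∷ r) = (v , d) ∷ r

-- Θ_e(n), n even, t = n/2 : (2t)• (2t-2)• ⋯ 2• 1⁺ 3• 5• ⋯ (2t-1)•
Thetae : ℕ → Word
Thetae n = allDot (applyUpTo (λ j → 2 * (t ∸ j)) t)
           ++ (1 , plus) ∷ allDot (applyUpTo (λ j → 2 * j + 3) (t ∸ 1))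
  where t = ⌊ n /2⌋

-- Θ_o(n), n = 2s+1 : (2s+1)• ⋯ 3• 1⁻ 2• 4• ⋯ (2s)•
Thetao : ℕ → Word
Thetao n = allDot (applyUpTo (λ j → 2 * (s ∸ j) + 1) s)
           ++ (1 , minus) ∷ allDot (applyUpTo (λ j → 2 * j + 2) s)
  where s = ⌊ n /2⌋

-- Λ_e(n), t = n/2 : positions 2j-1,2j hold t+j, t+1-j (j = 1..t); first entry ⁺
Lambdae : ℕ → Word
Lambdae n = setHeadDeco plus
  (allDot (concat (applyUpTo (λ j → (t + suc j) ∷ (t ∸ j) ∷ []) t)))
  where t = ⌊ n /2⌋

-- Λ_o(n), n = 2s+1, t = s+1 : t⁻ then pairs t+j, t-j (j = 1..s)
Lambdao : ℕ → Word
Lambdao n = (suc s , minus) ∷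
  allDot (concat (applyUpTo (λ j → (suc s + suc j) ∷ (s ∸ j) ∷ []) s))
  where s = ⌊ n /2⌋

-- Upper bound: reversing all of Θ (m + 2) leaves Θ (m + 1) followed by its maximum, and two reversals bring
-- the trailing 1 of Λ (m + 2) to the front, leaving a shifted copy of Λ m; so n reversals sort a word of length n.
-- Lower bound: a prefix reversal changes only the adjacency at its cut, so the number of breakpoints (adjacent
-- entries not in a common strip) of w followed by a sentinel (n + 1)⁺ is at most the number of reversals used,
-- and for clean compact w it is n.
-- Basis: a pattern of Θ n is V-shaped with its only signed entry at the value 1, a pattern of Λ n is a spiral
-- with its only signed entry in front, and in both cases the sign is that of the parity of n. A clean compact
-- peg permutation of this shape is an identity or a member F j of the family, possibly followed by j + 1, with
-- j of the parity of n; a proper one thus has j ≤ n - 2 and is sorted by n - 2 reversals.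
module Submission where

open import Defs
open import Data.Nat
open import Data.Nat.Properties
open import Data.Nat.DivMod using (_%_; [m+n]%n≡m%n)
open import Data.Fin as Fin using (Fin; toℕ; fromℕ<)
import Data.Fin.Properties as Fin
open import Data.List hiding (lookup)
import Data.List as List
open import Data.List.Properties
open import Data.List.Membership.Propositional using (_∈_)
open import Data.List.Membership.Propositional.Properties using (∈-applyUpTo⁺; ∈-applyUpTo⁻)
open import Data.List.Relation.Binary.Permutation.Propositional
  using (_↭_; prep; swap; ↭-refl; ↭-sym; module PermutationReasoning)
import Data.List.Relation.Binary.Permutation.Propositional.Properties as Perm
open import Data.List.Relation.Unary.All using (All; []; _∷_)
import Data.List.Relation.Unary.All.Properties as All
open import Data.List.Relation.Unary.Any using (here; there)
open import Data.Product hiding (map; swap)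
open import Data.Sum hiding (map; swap; [_,_])
open import Data.Sum using () renaming ([_,_] to either)
open import Data.Unit using (tt)
open import Function using (_∘_)
open import Relation.Binary.PropositionalEquality
open import Relation.Nullary
open import Relation.Nullary.Decidable using (_×-dec_; _⊎-dec_)

-- Prefix reversals

dotted : ℕ → ℕ × Deco
dotted v = (v , dot)

shiftEntry : ℕ × Deco → ℕ × Deco
shiftEntry (v , d) = (suc v , d)

shift : Word → Word
shift = map shiftEntry

flipRev : Word → Word
flipRev [] = []
flipRev (x ∷ l) = flipRev l ++ flipEntry x ∷ []

flipEntry-involutive : ∀ x → flipEntry (flipEntry x) ≡ x
flipEntry-involutive (v , plus) = refl
flipEntry-involutive (v , minus) = refl
flipEntry-involutive (v , dot) = refl

map-flipEntry-reverse : ∀ l → map flipEntry (reverse l) ≡ flipRev l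
map-flipEntry-reverse [] = refl
map-flipEntry-reverse (x ∷ l) = begin
    map flipEntry (reverse (x ∷ l))       ≡⟨ cong (map flipEntry) (unfold-reverse x l) ⟩
    map flipEntry (reverse l ++ x ∷ [])   ≡⟨ map-++ flipEntry (reverse l) (x ∷ []) ⟩
    map flipEntry (reverse l) ++ flipEntry x ∷ []
                                          ≡⟨ cong (_++ flipEntry x ∷ []) (map-flipEntry-reverse l) ⟩
    flipRev l ++ flipEntry x ∷ []         ∎
  where open ≡-Reasoning

flipRev-∷ʳ : ∀ l y → flipRev (l ++ y ∷ []) ≡ flipEntry y ∷ flipRev l
flipRev-∷ʳ [] y = refl
flipRev-∷ʳ (x ∷ l) y = cong (_++ flipEntry x ∷ []) (flipRev-∷ʳ l y)

flipRev-involutive : ∀ l → flipRev (flipRev l) ≡ l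
flipRev-involutive [] = refl
flipRev-involutive (x ∷ l) =
  trans (flipRev-∷ʳ (flipRev l) (flipEntry x))
        (cong₂ _∷_ (flipEntry-involutive x) (flipRev-involutive l))

length-∷ʳ : ∀ (w : Word) x → length (w ++ x ∷ []) ≡ suc (length w)
length-∷ʳ w x = trans (length-++-sucʳ w x []) (cong suc (cong length (++-identityʳ w)))

length-flipRev : ∀ l → length (flipRev l) ≡ length l
length-flipRev [] = refl
length-flipRev (x ∷ l) = trans (length-∷ʳ (flipRev l) _) (cong suc (length-flipRev l))

shift-flipRev : ∀ l → shift (flipRev l) ≡ flipRev (shift l)
shift-flipRev [] = refl
shift-flipRev ((v , d) ∷ l) = trans (map-++ shiftEntry (flipRev l) _) (cong (_++ _) (shift-flipRev l))

prefixRev-flipRev : ∀ i w → prefixRev i w ≡ flipRev (take i w) ++ drop i w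
prefixRev-flipRev i w = cong (_++ drop i w) (map-flipEntry-reverse (take i w))

take-++ˡ : ∀ i (w s : Word) → i ≤ length w → take i (w ++ s) ≡ take i w
take-++ˡ zero w s _ = refl
take-++ˡ (suc i) (x ∷ w) s (s≤s p) = cong (x ∷_) (take-++ˡ i w s p)

drop-++ˡ : ∀ i (w s : Word) → i ≤ length w → drop i (w ++ s) ≡ drop i w ++ s
drop-++ˡ zero w s _ = refl
drop-++ˡ (suc i) (x ∷ w) s (s≤s p) = drop-++ˡ i w s p

prefixRev-++ : ∀ i w s → i ≤ length w → prefixRev i (w ++ s) ≡ prefixRev i w ++ s
prefixRev-++ i w s p = begin
    prefixRev i (w ++ s)                      ≡⟨ prefixRev-flipRev i (w ++ s) ⟩
    flipRev (take i (w ++ s)) ++ drop i (w ++ s)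
                                              ≡⟨ cong₂ (λ a b → flipRev a ++ b) (take-++ˡ i w s p) (drop-++ˡ i w s p) ⟩
    flipRev (take i w) ++ drop i w ++ s       ≡⟨ ++-assoc (flipRev (take i w)) (drop i w) s ⟨
    (flipRev (take i w) ++ drop i w) ++ s     ≡⟨ cong (_++ s) (prefixRev-flipRev i w) ⟨
    prefixRev i w ++ s                        ∎
  where open ≡-Reasoning

length-prefixRev : ∀ i w → length (prefixRev i w) ≡ length w
length-prefixRev i w = begin
    length (prefixRev i w)                              ≡⟨ cong length (prefixRev-flipRev i w) ⟩
    length (flipRev (take i w) ++ drop i w)             ≡⟨ length-++ (flipRev (take i w)) ⟩
    length (flipRev (take i w)) + length (drop i w)     ≡⟨ cong (_+ length (drop i w)) (length-flipRev (take i w)) ⟩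
    length (take i w) + length (drop i w)               ≡⟨ length-++ (take i w) ⟨
    length (take i w ++ drop i w)                       ≡⟨ cong length (take++drop≡id i w) ⟩
    length w                                            ∎
  where open ≡-Reasoning

prefixRev-length : ∀ w → prefixRev (length w) w ≡ flipRev w
prefixRev-length w = begin
    prefixRev (length w) w                          ≡⟨ prefixRev-flipRev (length w) w ⟩
    flipRev (take (length w) w) ++ drop (length w) w
                                                    ≡⟨ cong₂ (λ a b → flipRev a ++ b) (take-all _ w ≤-refl) (drop-all _ w ≤-refl) ⟩
    flipRev w ++ []                                 ≡⟨ ++-identityʳ (flipRev w) ⟩
    flipRev w                                       ∎
  where open ≡-Reasoning

shift-prefixRev : ∀ i w → shift (prefixRev i w) ≡ prefixRev i (shift w)
shift-prefixRev i w = begin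
    shift (prefixRev i w)                           ≡⟨ cong shift (prefixRev-flipRev i w) ⟩
    shift (flipRev (take i w) ++ drop i w)          ≡⟨ map-++ shiftEntry (flipRev (take i w)) (drop i w) ⟩
    shift (flipRev (take i w)) ++ shift (drop i w)
      ≡⟨ cong₂ _++_ (trans (shift-flipRev (take i w)) (cong flipRev (sym (take-map i w)))) (sym (drop-map i w)) ⟩
    flipRev (take i (shift w)) ++ drop i (shift w)  ≡⟨ prefixRev-flipRev i (shift w) ⟨
    prefixRev i (shift w)                           ∎
  where open ≡-Reasoning

-- Upper bounds on the number of prefix reversals

values-shift : ∀ w → values (shift w) ≡ map suc (values w)
values-shift w = trans (sym (map-∘ w)) (map-∘ w)

length-shift : ∀ w → length (shift w) ≡ length w
length-shift = length-map shiftEntry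

appendTop : Deco → Word → Word
appendTop d w = w ++ (suc (length w) , d) ∷ []

appendMax : Word → Word
appendMax = appendTop dot

isIdentity-appendTop : ∀ {d} w → PlusOrDot d → IsIdentity w → IsIdentity (appendTop d w)
isIdentity-appendTop {d} w d⁺ (v , ds) = vs , All.++⁺ ds (d⁺ ∷ [])
  where
  vs : values (appendTop d w) ≡ applyUpTo suc (length (appendTop d w))
  vs = begin
      values (appendTop d w)                            ≡⟨ map-++ proj₁ w _ ⟩
      values w ++ suc (length w) ∷ []                   ≡⟨ cong (_++ suc (length w) ∷ []) v ⟩
      applyUpTo suc (length w) ++ suc (length w) ∷ []   ≡⟨ applyUpTo-∷ʳ suc (length w) ⟩
      applyUpTo suc (suc (length w))                    ≡⟨ cong (applyUpTo suc) (length-∷ʳ w _) ⟨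
      applyUpTo suc (length (appendTop d w))            ∎
    where open ≡-Reasoning

isIdentity-consOne : ∀ w → IsIdentity w → IsIdentity (dotted 1 ∷ shift w)
isIdentity-consOne w (v , ds) = cong (1 ∷_) vs , inj₂ refl ∷ All.map⁺ ds
  where
  vs : values (shift w) ≡ applyUpTo (suc ∘ suc) (length (shift w))
  vs = begin
      values (shift w)                          ≡⟨ values-shift w ⟩
      map suc (values w)                        ≡⟨ cong (map suc) v ⟩
      map suc (applyUpTo suc (length w))        ≡⟨ map-applyUpTo suc suc (length w) ⟩
      applyUpTo (suc ∘ suc) (length w)          ≡⟨ cong (applyUpTo (suc ∘ suc)) (length-shift w) ⟨
      applyUpTo (suc ∘ suc) (length (shift w))  ∎
    where open ≡-Reasoning

sortableWithin-mono : ∀ {k k′ w} → k ≤ k′ → SortableWithin k w → SortableWithin k′ w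
sortableWithin-mono _ (done isId) = done isId
sortableWithin-mono (s≤s k≤k′) (step i 1≤i i≤n s) = step i 1≤i i≤n (sortableWithin-mono k≤k′ s)

prefixRev-appendTop : ∀ {d} i w → i ≤ length w → prefixRev i (appendTop d w) ≡ appendTop d (prefixRev i w)
prefixRev-appendTop {d} i w i≤n = begin
    prefixRev i (w ++ (suc (length w) , d) ∷ [])   ≡⟨ prefixRev-++ i w _ i≤n ⟩
    prefixRev i w ++ (suc (length w) , d) ∷ []     ≡⟨ cong (λ n → prefixRev i w ++ (suc n , d) ∷ []) (length-prefixRev i w) ⟨
    appendTop d (prefixRev i w)                    ∎
  where open ≡-Reasoning

sortableWithin-appendMax : ∀ {k} w → SortableWithin k w → SortableWithin k (appendMax w)
sortableWithin-appendMax w (done isId) = done (isIdentity-appendTop w (inj₂ refl) isId)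
sortableWithin-appendMax w (step i 1≤i i≤n s) =
  step i 1≤i (≤-trans i≤n (≤-trans (n≤1+n _) (≤-reflexive (sym (length-∷ʳ w _)))))
    (subst (SortableWithin _) (sym (prefixRev-appendTop i w i≤n)) (sortableWithin-appendMax (prefixRev i w) s))

prefixRev-rotate : ∀ u x → prefixRev (suc (length u)) (prefixRev (length u) (u ++ x ∷ [])) ≡ flipEntry x ∷ u
prefixRev-rotate u x = begin
    prefixRev (suc (length u)) (prefixRev (length u) (u ++ x ∷ []))
      ≡⟨ cong (prefixRev (suc (length u))) (prefixRev-++ (length u) u (x ∷ []) ≤-refl) ⟩
    prefixRev (suc (length u)) (prefixRev (length u) u ++ x ∷ [])
      ≡⟨ cong (λ v → prefixRev (suc (length u)) (v ++ x ∷ [])) (prefixRev-length u) ⟩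
    prefixRev (suc (length u)) (flipRev u ++ x ∷ [])
      ≡⟨ cong (λ n → prefixRev (suc n) (flipRev u ++ x ∷ [])) (length-flipRev u) ⟨
    prefixRev (suc (length (flipRev u))) (flipRev u ++ x ∷ [])
      ≡⟨ cong (λ n → prefixRev n (flipRev u ++ x ∷ [])) (length-∷ʳ (flipRev u) x) ⟨
    prefixRev (length (flipRev u ++ x ∷ [])) (flipRev u ++ x ∷ [])
      ≡⟨ prefixRev-length (flipRev u ++ x ∷ []) ⟩
    flipRev (flipRev u ++ x ∷ [])
      ≡⟨ flipRev-∷ʳ (flipRev u) x ⟩
    flipEntry x ∷ flipRev (flipRev u)
      ≡⟨ cong (flipEntry x ∷_) (flipRev-involutive u) ⟩
    flipEntry x ∷ u ∎
  where open ≡-Reasoning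

sortableWithin-rotate : ∀ {k} u x → 1 ≤ length u → IsIdentity (flipEntry x ∷ u) →
                        SortableWithin (2 + k) (u ++ x ∷ [])
sortableWithin-rotate u x 1≤n isId =
  step (length u) 1≤n (≤-trans (n≤1+n _) (≤-reflexive (sym (length-∷ʳ u x))))
    (step (suc (length u)) (s≤s z≤n) (≤-reflexive (sym (trans (length-prefixRev (length u) (u ++ x ∷ [])) (length-∷ʳ u x))))
      (done (subst IsIdentity (sym (prefixRev-rotate u x)) isId)))

lift : Word → Word
lift w = shift w ++ dotted (2 + length w) ∷ dotted 1 ∷ []

lift-appendMax : ∀ w → lift w ≡ shift (appendMax w) ++ dotted 1 ∷ []
lift-appendMax w = begin
    shift w ++ dotted (2 + length w) ∷ dotted 1 ∷ []    ≡⟨ ++-assoc (shift w) _ _ ⟨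
    (shift w ++ dotted (2 + length w) ∷ []) ++ dotted 1 ∷ []
                                                        ≡⟨ cong (_++ dotted 1 ∷ []) (map-++ shiftEntry w _) ⟨
    shift (appendMax w) ++ dotted 1 ∷ []                ∎
  where open ≡-Reasoning

prefixRev-lift : ∀ i w → i ≤ length w → prefixRev i (lift w) ≡ lift (prefixRev i w)
prefixRev-lift i w i≤n = begin
    prefixRev i (shift w ++ dotted (2 + length w) ∷ dotted 1 ∷ [])
      ≡⟨ prefixRev-++ i (shift w) _ (≤-trans i≤n (≤-reflexive (sym (length-shift w)))) ⟩
    prefixRev i (shift w) ++ dotted (2 + length w) ∷ dotted 1 ∷ []
      ≡⟨ cong₂ (λ v n → v ++ dotted (2 + n) ∷ dotted 1 ∷ []) (shift-prefixRev i w) (length-prefixRev i w) ⟨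
    lift (prefixRev i w) ∎
  where open ≡-Reasoning

sortableWithin-lift : ∀ {k} w → SortableWithin k w → SortableWithin (2 + k) (lift w)
sortableWithin-lift w (done isId) =
  subst (SortableWithin _) (sym (lift-appendMax w))
    (sortableWithin-rotate (shift (appendMax w)) (dotted 1)
      (≤-trans (s≤s z≤n) (≤-reflexive (sym (trans (length-shift (appendMax w)) (length-∷ʳ w _)))))
      (isIdentity-consOne (appendMax w) (isIdentity-appendTop w (inj₂ refl) isId)))
sortableWithin-lift w (step i 1≤i i≤n s) =
  step i 1≤i (≤-trans i≤n (≤-trans (≤-reflexive (sym (length-shift w))) (length-++-≤ˡ (shift w))))
    (subst (SortableWithin _) (sym (prefixRev-lift i w i≤n)) (sortableWithin-lift (prefixRev i w) s))

-- The breakpoint lower bound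

InStrip : ℕ × Deco → ℕ × Deco → Set
InStrip x y = IncAdj x y ⊎ DecAdj x y

plusOrDot? : ∀ d → Dec (PlusOrDot d)
plusOrDot? plus = yes (inj₁ refl)
plusOrDot? minus = no λ { (inj₁ ()) ; (inj₂ ()) }
plusOrDot? dot = yes (inj₂ refl)

minusOrDot? : ∀ d → Dec (MinusOrDot d)
minusOrDot? plus = no λ { (inj₁ ()) ; (inj₂ ()) }
minusOrDot? minus = yes (inj₁ refl)
minusOrDot? dot = yes (inj₂ refl)

inStrip? : ∀ x y → Dec (InStrip x y)
inStrip? (a , d) (b , e) =
  ((b ≟ suc a) ×-dec plusOrDot? d ×-dec plusOrDot? e) ⊎-dec ((a ≟ suc b) ×-dec minusOrDot? d ×-dec minusOrDot? e)

minusOrDot-flip : ∀ {d} → PlusOrDot d → MinusOrDot (flipDeco d)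
minusOrDot-flip (inj₁ refl) = inj₁ refl
minusOrDot-flip (inj₂ refl) = inj₂ refl

plusOrDot-flip : ∀ {d} → MinusOrDot d → PlusOrDot (flipDeco d)
plusOrDot-flip (inj₁ refl) = inj₁ refl
plusOrDot-flip (inj₂ refl) = inj₂ refl

flipDeco-involutive : ∀ d → flipDeco (flipDeco d) ≡ d
flipDeco-involutive plus = refl
flipDeco-involutive minus = refl
flipDeco-involutive dot = refl

inStrip-flip : ∀ x y → InStrip x y → InStrip (flipEntry y) (flipEntry x)
inStrip-flip _ _ (inj₁ (p , d⁺ , e⁺)) = inj₂ (p , minusOrDot-flip e⁺ , minusOrDot-flip d⁺)
inStrip-flip _ _ (inj₂ (p , d⁻ , e⁻)) = inj₁ (p , plusOrDot-flip e⁻ , plusOrDot-flip d⁻)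

inStrip-unflip : ∀ x y → InStrip (flipEntry y) (flipEntry x) → InStrip x y
inStrip-unflip x y s = subst₂ InStrip (flipEntry-involutive x) (flipEntry-involutive y)
  (inStrip-flip (flipEntry y) (flipEntry x) s)

breakpoint : ℕ × Deco → ℕ × Deco → ℕ
breakpoint x y with inStrip? x y
... | yes _ = 0
... | no _ = 1

breakpoint≤1 : ∀ x y → breakpoint x y ≤ 1
breakpoint≤1 x y with inStrip? x y
... | yes _ = z≤n
... | no _ = s≤s z≤n

breakpoint-inStrip : ∀ x y → InStrip x y → breakpoint x y ≡ 0
breakpoint-inStrip x y s with inStrip? x y
... | yes _ = refl
... | no ¬s = contradiction s ¬s

breakpoint-notInStrip : ∀ x y → ¬ InStrip x y → breakpoint x y ≡ 1
breakpoint-notInStrip x y ¬s with inStrip? x y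
... | yes s = contradiction s ¬s
... | no _ = refl

breakpoint-flip : ∀ x y → breakpoint (flipEntry y) (flipEntry x) ≡ breakpoint x y
breakpoint-flip x y with inStrip? x y
... | yes s = breakpoint-inStrip _ _ (inStrip-flip x y s)
... | no ¬s = breakpoint-notInStrip _ _ (¬s ∘ inStrip-unflip x y)

breakpoints : Word → ℕ
breakpoints [] = 0
breakpoints (x ∷ []) = 0
breakpoints (x ∷ y ∷ w) = breakpoint x y + breakpoints (y ∷ w)

breakpoints-++-≤ : ∀ u v → breakpoints (u ++ v) ≤ suc (breakpoints u + breakpoints v)
breakpoints-++-≤ [] v = n≤1+n _
breakpoints-++-≤ (x ∷ []) [] = z≤n
breakpoints-++-≤ (x ∷ []) (y ∷ v) = +-monoˡ-≤ (breakpoints (y ∷ v)) (breakpoint≤1 x y)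
breakpoints-++-≤ (x ∷ y ∷ u) v = begin
    breakpoint x y + breakpoints (y ∷ u ++ v)                 ≤⟨ +-monoʳ-≤ (breakpoint x y) (breakpoints-++-≤ (y ∷ u) v) ⟩
    breakpoint x y + suc (breakpoints (y ∷ u) + breakpoints v) ≡⟨ +-suc (breakpoint x y) _ ⟩
    suc (breakpoint x y + (breakpoints (y ∷ u) + breakpoints v)) ≡⟨ cong suc (+-assoc (breakpoint x y) _ _) ⟨
    suc (breakpoint x y + breakpoints (y ∷ u) + breakpoints v)   ∎
  where open ≤-Reasoning

breakpoints-++-≥ : ∀ u v → breakpoints u + breakpoints v ≤ breakpoints (u ++ v)
breakpoints-++-≥ [] v = ≤-refl
breakpoints-++-≥ (x ∷ []) [] = z≤n
breakpoints-++-≥ (x ∷ []) (y ∷ v) = m≤n+m _ (breakpoint x y)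
breakpoints-++-≥ (x ∷ y ∷ u) v = begin
    breakpoint x y + breakpoints (y ∷ u) + breakpoints v     ≡⟨ +-assoc (breakpoint x y) _ _ ⟩
    breakpoint x y + (breakpoints (y ∷ u) + breakpoints v)   ≤⟨ +-monoʳ-≤ (breakpoint x y) (breakpoints-++-≥ (y ∷ u) v) ⟩
    breakpoint x y + breakpoints (y ∷ u ++ v)                ∎
  where open ≤-Reasoning

breakpoints-∷ʳ-∷ʳ : ∀ u x y → breakpoints (u ++ x ∷ y ∷ []) ≡ breakpoints (u ++ x ∷ []) + breakpoint x y
breakpoints-∷ʳ-∷ʳ [] x y = +-comm (breakpoint x y) 0
breakpoints-∷ʳ-∷ʳ (z ∷ []) x y =
  trans (cong (breakpoint z x +_) (+-identityʳ _)) (cong (_+ breakpoint x y) (sym (+-identityʳ _)))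
breakpoints-∷ʳ-∷ʳ (z ∷ z' ∷ u) x y =
  trans (cong (breakpoint z z' +_) (breakpoints-∷ʳ-∷ʳ (z' ∷ u) x y)) (sym (+-assoc (breakpoint z z') _ _))

breakpoints-flipRev : ∀ u → breakpoints (flipRev u) ≡ breakpoints u
breakpoints-flipRev [] = refl
breakpoints-flipRev (x ∷ []) = refl
breakpoints-flipRev (x ∷ y ∷ u) = begin
    breakpoints ((flipRev u ++ flipEntry y ∷ []) ++ flipEntry x ∷ [])
      ≡⟨ cong breakpoints (++-assoc (flipRev u) _ _) ⟩
    breakpoints (flipRev u ++ flipEntry y ∷ flipEntry x ∷ [])
      ≡⟨ breakpoints-∷ʳ-∷ʳ (flipRev u) (flipEntry y) (flipEntry x) ⟩
    breakpoints (flipRev (y ∷ u)) + breakpoint (flipEntry y) (flipEntry x)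
      ≡⟨ cong₂ _+_ (breakpoints-flipRev (y ∷ u)) (breakpoint-flip x y) ⟩
    breakpoints (y ∷ u) + breakpoint x y
      ≡⟨ +-comm (breakpoints (y ∷ u)) (breakpoint x y) ⟩
    breakpoint x y + breakpoints (y ∷ u) ∎
  where open ≡-Reasoning

breakpoints-prefixRev : ∀ i w → breakpoints w ≤ suc (breakpoints (prefixRev i w))
breakpoints-prefixRev i w = begin
    breakpoints w                                                      ≡⟨ cong breakpoints (take++drop≡id i w) ⟨
    breakpoints (take i w ++ drop i w)                                 ≤⟨ breakpoints-++-≤ (take i w) (drop i w) ⟩
    suc (breakpoints (take i w) + breakpoints (drop i w))              ≡⟨ cong (λ b → suc (b + breakpoints (drop i w))) (breakpoints-flipRev (take i w)) ⟨
    suc (breakpoints (flipRev (take i w)) + breakpoints (drop i w))    ≤⟨ s≤s (breakpoints-++-≥ (flipRev (take i w)) (drop i w)) ⟩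
    suc (breakpoints (flipRev (take i w) ++ drop i w))                 ≡⟨ cong (suc ∘ breakpoints) (prefixRev-flipRev i w) ⟨
    suc (breakpoints (prefixRev i w))                                  ∎
  where open ≤-Reasoning

breakpoints-consecutive : ∀ (f : ℕ → ℕ) → (∀ i → f (suc i) ≡ suc (f i)) → ∀ u →
                          values u ≡ applyUpTo f (length u) → All (PlusOrDot ∘ proj₂) u → breakpoints u ≡ 0
breakpoints-consecutive f f-suc [] _ _ = refl
breakpoints-consecutive f f-suc (x ∷ []) _ _ = refl
breakpoints-consecutive f f-suc (x ∷ y ∷ u) vs (x⁺ ∷ y⁺ ∷ u⁺) =
  cong₂ _+_ (breakpoint-inStrip x y (inj₁ (y≡1+x , x⁺ , y⁺)))
            (breakpoints-consecutive (f ∘ suc) (f-suc ∘ suc) (y ∷ u) vs′ (y⁺ ∷ u⁺))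
  where
  vs′ = proj₂ (∷-injective vs)
  y≡1+x : proj₁ y ≡ suc (proj₁ x)
  y≡1+x = trans (proj₁ (∷-injective vs′)) (trans (f-suc 0) (cong suc (sym (proj₁ (∷-injective vs)))))

breakpoints-isIdentity : ∀ w → IsIdentity w → breakpoints w ≡ 0
breakpoints-isIdentity w (vs , ds) = breakpoints-consecutive suc (λ _ → refl) w vs ds

breakpoints-appendTop-≤ : ∀ {j} w → SortableWithin j w → breakpoints (appendTop plus w) ≤ j
breakpoints-appendTop-≤ w (done isId) =
  subst (_≤ _) (sym (breakpoints-isIdentity (appendTop plus w) (isIdentity-appendTop w (inj₁ refl) isId))) z≤n
breakpoints-appendTop-≤ {suc j} w (step i _ i≤n s) = begin
    breakpoints (appendTop plus w)                        ≤⟨ breakpoints-prefixRev i (appendTop plus w) ⟩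
    suc (breakpoints (prefixRev i (appendTop plus w)))    ≡⟨ cong (suc ∘ breakpoints) (prefixRev-appendTop i w i≤n) ⟩
    suc (breakpoints (appendTop plus (prefixRev i w)))    ≤⟨ s≤s (breakpoints-appendTop-≤ (prefixRev i w) s) ⟩
    suc j                                                 ∎
  where open ≤-Reasoning

breakpoints-cleanCompact : ∀ w → CleanCompact w → breakpoints w ≡ length w ∸ 1
breakpoints-cleanCompact [] _ = refl
breakpoints-cleanCompact (x ∷ []) _ = refl
breakpoints-cleanCompact (x ∷ y ∷ w) (¬inc , ¬dec , cc) =
  cong₂ _+_ (breakpoint-notInStrip x y (either ¬inc ¬dec)) (breakpoints-cleanCompact (y ∷ w) cc)

length≤sortingBound : ∀ {j} w → CleanCompact (appendTop plus w) → SortableWithin j w → length w ≤ j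
length≤sortingBound {j} w cc s =
  subst (_≤ j) (trans (breakpoints-cleanCompact _ cc) (cong (_∸ 1) (length-∷ʳ w _))) (breakpoints-appendTop-≤ w s)

-- The families Θ and Λ

-- Θ m and Λ m are Θ_e(m), Λ_e(m) for even m and Θ_o(m), Λ_o(m) for odd m, built by a recursion of step two:
-- Θ (m + 2) surrounds Θ m by the two new largest values, Λ (m + 2) is Λ m shifted up and followed by m + 2, 1.
Θ : ℕ → Word
Θ zero = []
Θ (suc zero) = (1 , minus) ∷ []
Θ (suc (suc zero)) = (2 , dot) ∷ (1 , plus) ∷ []
Θ (suc (suc (suc m))) = dotted (3 + m) ∷ Θ (suc m) ++ dotted (2 + m) ∷ []

Λ : ℕ → Word
Λ zero = []
Λ (suc zero) = (1 , minus) ∷ []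
Λ (suc (suc zero)) = (2 , plus) ∷ (1 , dot) ∷ []
Λ (suc (suc (suc m))) = shift (Λ (suc m)) ++ dotted (3 + m) ∷ dotted 1 ∷ []

length-Θ : ∀ m → length (Θ m) ≡ m
length-Θ zero = refl
length-Θ (suc zero) = refl
length-Θ (suc (suc zero)) = refl
length-Θ (suc (suc (suc m))) = cong suc (trans (length-∷ʳ (Θ (suc m)) _) (cong suc (length-Θ (suc m))))

length-Λ : ∀ m → length (Λ m) ≡ m
length-Λ zero = refl
length-Λ (suc zero) = refl
length-Λ (suc (suc zero)) = refl
length-Λ (suc (suc (suc m))) = begin
    length (shift (Λ (suc m)) ++ dotted (3 + m) ∷ dotted 1 ∷ [])  ≡⟨ length-++ (shift (Λ (suc m))) ⟩
    length (shift (Λ (suc m))) + 2                               ≡⟨ +-comm (length (shift (Λ (suc m)))) 2 ⟩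
    2 + length (shift (Λ (suc m)))                               ≡⟨ cong (2 +_) (trans (length-shift (Λ (suc m))) (length-Λ (suc m))) ⟩
    3 + m                                                        ∎
  where open ≡-Reasoning

Θ-appendMax : ∀ m → appendMax (Θ m) ≡ Θ m ++ dotted (suc m) ∷ []
Θ-appendMax m = cong (λ n → Θ m ++ dotted (suc n) ∷ []) (length-Θ m)

Λ-lift : ∀ m → lift (Λ (suc m)) ≡ Λ (3 + m)
Λ-lift m = cong (λ n → shift (Λ (suc m)) ++ dotted (2 + n) ∷ dotted 1 ∷ []) (length-Λ (suc m))

flipRev-Θ : ∀ m → flipRev (Θ (2 + m)) ≡ Θ (suc m) ++ dotted (2 + m) ∷ []
flipRev-Θ zero = refl
flipRev-Θ (suc zero) = refl
flipRev-Θ (suc (suc m)) = begin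
    flipRev (Θ (2 + m) ++ dotted (3 + m) ∷ []) ++ dotted (4 + m) ∷ []
      ≡⟨ cong (_++ dotted (4 + m) ∷ []) (flipRev-∷ʳ (Θ (2 + m)) _) ⟩
    dotted (3 + m) ∷ flipRev (Θ (2 + m)) ++ dotted (4 + m) ∷ []
      ≡⟨ cong (λ w → dotted (3 + m) ∷ w ++ dotted (4 + m) ∷ []) (flipRev-Θ m) ⟩
    dotted (3 + m) ∷ (Θ (suc m) ++ dotted (2 + m) ∷ []) ++ dotted (4 + m) ∷ [] ∎
  where open ≡-Reasoning

sortableWithin-Θ : ∀ m → SortableWithin m (Θ m)
sortableWithin-Θ zero = done (refl , [])
sortableWithin-Θ (suc zero) = step 1 (s≤s z≤n) (s≤s z≤n) (done (refl , inj₁ refl ∷ []))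
sortableWithin-Θ (suc (suc m)) =
  step (2 + m) (s≤s z≤n) (≤-reflexive (sym (length-Θ (2 + m))))
    (subst (SortableWithin (suc m)) (sym reversed)
      (subst (SortableWithin (suc m)) (Θ-appendMax (suc m)) (sortableWithin-appendMax (Θ (suc m)) (sortableWithin-Θ (suc m)))))
  where
  reversed : prefixRev (2 + m) (Θ (2 + m)) ≡ Θ (suc m) ++ dotted (2 + m) ∷ []
  reversed = trans (cong (λ n → prefixRev n (Θ (2 + m))) (sym (length-Θ (2 + m))))
                   (trans (prefixRev-length (Θ (2 + m))) (flipRev-Θ m))

sortableWithin-Λ : ∀ m → SortableWithin m (Λ m)
sortableWithin-Λ zero = done (refl , [])
sortableWithin-Λ (suc zero) = step 1 (s≤s z≤n) (s≤s z≤n) (done (refl , inj₁ refl ∷ []))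
sortableWithin-Λ (suc (suc zero)) =
  step 1 (s≤s z≤n) (s≤s z≤n) (step 2 (s≤s z≤n) (s≤s (s≤s z≤n)) (done (refl , inj₂ refl ∷ inj₁ refl ∷ [])))
sortableWithin-Λ (suc (suc (suc m))) =
  subst (SortableWithin (3 + m)) (Λ-lift m) (sortableWithin-lift (Λ (suc m)) (sortableWithin-Λ (suc m)))

values-∷ʳ : ∀ (w : Word) v d → values (w ++ (v , d) ∷ []) ≡ values w ++ v ∷ []
values-∷ʳ w v d = map-++ proj₁ w _

isPegPerm-Θ : ∀ m → IsPegPerm (Θ m)
isPegPerm-Θ m = subst (λ n → values (Θ m) ↭ applyUpTo suc n) (sym (length-Θ m)) (values-Θ m)
  where
  values-Θ : ∀ m → values (Θ m) ↭ applyUpTo suc m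
  values-Θ zero = ↭-refl
  values-Θ (suc zero) = ↭-refl
  values-Θ (suc (suc zero)) = swap 2 1 ↭-refl
  values-Θ (suc (suc (suc m))) = begin
      3 + m ∷ values (Θ (suc m) ++ dotted (2 + m) ∷ [])      ≡⟨ cong (3 + m ∷_) (values-∷ʳ (Θ (suc m)) _ _) ⟩
      3 + m ∷ (values (Θ (suc m)) ++ 2 + m ∷ [])             ↭⟨ prep (3 + m) (Perm.++⁺ʳ _ (values-Θ (suc m))) ⟩
      (3 + m ∷ []) ++ (applyUpTo suc (suc m) ++ 2 + m ∷ [])  ↭⟨ Perm.++-comm (3 + m ∷ []) _ ⟩
      (applyUpTo suc (suc m) ++ 2 + m ∷ []) ++ 3 + m ∷ []    ≡⟨ cong (_++ 3 + m ∷ []) (applyUpTo-∷ʳ suc (suc m)) ⟩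
      applyUpTo suc (2 + m) ++ 3 + m ∷ []                    ≡⟨ applyUpTo-∷ʳ suc (2 + m) ⟩
      applyUpTo suc (3 + m)                                  ∎
    where open PermutationReasoning

isPegPerm-Λ : ∀ m → IsPegPerm (Λ m)
isPegPerm-Λ m = subst (λ n → values (Λ m) ↭ applyUpTo suc n) (sym (length-Λ m)) (values-Λ m)
  where
  values-Λ : ∀ m → values (Λ m) ↭ applyUpTo suc m
  values-Λ zero = ↭-refl
  values-Λ (suc zero) = ↭-refl
  values-Λ (suc (suc zero)) = swap 2 1 ↭-refl
  values-Λ (suc (suc (suc m))) = begin
      values (shift (Λ (suc m)) ++ dotted (3 + m) ∷ dotted 1 ∷ [])
        ≡⟨ map-++ proj₁ (shift (Λ (suc m))) _ ⟩
      values (shift (Λ (suc m))) ++ 3 + m ∷ 1 ∷ []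
        ≡⟨ cong (_++ 3 + m ∷ 1 ∷ []) (values-shift (Λ (suc m))) ⟩
      map suc (values (Λ (suc m))) ++ 3 + m ∷ 1 ∷ []
        ↭⟨ Perm.++⁺ʳ _ (Perm.map⁺ suc (values-Λ (suc m))) ⟩
      map suc (applyUpTo suc (suc m)) ++ 3 + m ∷ 1 ∷ []
        ≡⟨ cong (_++ 3 + m ∷ 1 ∷ []) (map-applyUpTo suc suc (suc m)) ⟩
      applyUpTo (suc ∘ suc) (suc m) ++ 3 + m ∷ 1 ∷ []
        ≡⟨ ++-assoc (applyUpTo (suc ∘ suc) (suc m)) (3 + m ∷ []) (1 ∷ []) ⟨
      (applyUpTo (suc ∘ suc) (suc m) ++ 3 + m ∷ []) ++ 1 ∷ []
        ↭⟨ Perm.++-comm _ (1 ∷ []) ⟩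
      1 ∷ (applyUpTo (suc ∘ suc) (suc m) ++ 3 + m ∷ [])
        ≡⟨ cong (1 ∷_) (applyUpTo-∷ʳ (suc ∘ suc) (suc m)) ⟩
      applyUpTo suc (3 + m) ∎
    where open PermutationReasoning

cleanCompact-++ : ∀ l x r → CleanCompact (l ++ x ∷ []) → CleanCompact (x ∷ r) → CleanCompact (l ++ x ∷ r)
cleanCompact-++ [] x r _ cc = cc
cleanCompact-++ (a ∷ []) x r (¬inc , ¬dec , _) cc = ¬inc , ¬dec , cc
cleanCompact-++ (a ∷ b ∷ l) x r (¬inc , ¬dec , ccˡ) cc = ¬inc , ¬dec , cleanCompact-++ (b ∷ l) x r ccˡ cc

cleanCompact-init : ∀ l x → CleanCompact (l ++ x ∷ []) → CleanCompact l
cleanCompact-init [] x _ = tt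
cleanCompact-init (a ∷ []) x _ = tt
cleanCompact-init (a ∷ b ∷ l) x (¬inc , ¬dec , cc) = ¬inc , ¬dec , cleanCompact-init (b ∷ l) x cc

cleanCompact-tail : ∀ x w → CleanCompact (x ∷ w) → CleanCompact w
cleanCompact-tail x [] _ = tt
cleanCompact-tail x (y ∷ w) (_ , _ , cc) = cc

cleanCompact-middle : ∀ l x y r → CleanCompact (l ++ x ∷ y ∷ r) → ¬ IncAdj x y × ¬ DecAdj x y
cleanCompact-middle [] x y r (¬inc , ¬dec , _) = ¬inc , ¬dec
cleanCompact-middle (z ∷ []) x y r (_ , _ , cc) = cleanCompact-middle [] x y r cc
cleanCompact-middle (z ∷ z' ∷ l) x y r (_ , _ , cc) = cleanCompact-middle (z' ∷ l) x y r cc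

cleanCompact-last : ∀ l x y → CleanCompact ((l ++ x ∷ []) ++ y ∷ []) → ¬ IncAdj x y × ¬ DecAdj x y
cleanCompact-last l x y cc = cleanCompact-middle l x y [] (subst CleanCompact (++-assoc l (x ∷ []) (y ∷ [])) cc)

cleanCompact-shift : ∀ l → CleanCompact l → CleanCompact (shift l)
cleanCompact-shift [] _ = tt
cleanCompact-shift (a ∷ []) _ = tt
cleanCompact-shift ((a , d) ∷ (b , e) ∷ l) (¬inc , ¬dec , cc) =
  (λ (p , q , r) → ¬inc (suc-injective p , q , r)) ,
  (λ (p , q , r) → ¬dec (suc-injective p , q , r)) , cleanCompact-shift ((b , e) ∷ l) cc

cleanCompact-unshift : ∀ l → CleanCompact (shift l) → CleanCompact l
cleanCompact-unshift [] _ = tt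
cleanCompact-unshift (a ∷ []) _ = tt
cleanCompact-unshift ((a , d) ∷ (b , e) ∷ l) (¬inc , ¬dec , cc) =
  (λ (p , q , r) → ¬inc (cong suc p , q , r)) ,
  (λ (p , q , r) → ¬dec (cong suc p , q , r)) , cleanCompact-unshift ((b , e) ∷ l) cc

n≢1+m+n : ∀ m n → n ≢ suc (m + n)
n≢1+m+n m zero ()
n≢1+m+n m (suc n) e = n≢1+m+n m n (trans (suc-injective e) (+-suc m n))

Θ-head : ∀ m → ∃₂ λ d r → Θ (suc m) ≡ (suc m , d) ∷ r × MinusOrDot d
Θ-head zero = minus , [] , refl , inj₁ refl
Θ-head (suc zero) = dot , _ , refl , inj₂ refl
Θ-head (suc (suc m)) = dot , _ , refl , inj₂ refl

Λ-last : ∀ m → ∃₂ λ d l → Λ (suc m) ≡ l ++ (1 , d) ∷ [] × MinusOrDot d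
Λ-last zero = minus , [] , refl , inj₁ refl
Λ-last (suc zero) = dot , (2 , plus) ∷ [] , refl , inj₂ refl
Λ-last (suc (suc m)) = dot , shift (Λ (suc m)) ++ dotted (3 + m) ∷ [] , sym (++-assoc (shift (Λ (suc m))) _ _) , inj₂ refl

cleanCompact-Θ-top : ∀ m e → CleanCompact (Θ m ++ (suc m , e) ∷ [])
cleanCompact-Θ-top zero e = tt
cleanCompact-Θ-top (suc zero) e = (λ { (_ , inj₁ () , _) ; (_ , inj₂ () , _) }) , (λ { (() , _) }) , tt
cleanCompact-Θ-top (suc (suc zero)) e =
  (λ { (() , _) }) , (λ { (_ , _ , inj₁ ()) ; (_ , _ , inj₂ ()) }) , (λ { (() , _) }) , (λ { (() , _) }) , tt
cleanCompact-Θ-top (suc (suc (suc m))) e with Θ-head m | cleanCompact-Θ-top (suc m) dot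
... | d , r , Θ≡ , _ | ccΘ = subst (λ w → CleanCompact (dotted (3 + m) ∷ w)) (sym inner≡)
      ((λ (p , _) → n≢1+m+n 2 (suc m) p) , (λ (p , _) → n≢1+m+n 0 (2 + m) (sym p)) , subst CleanCompact inner≡ inner)
  where
  inner : CleanCompact ((Θ (suc m) ++ dotted (2 + m) ∷ []) ++ (4 + m , e) ∷ [])
  inner = subst CleanCompact (sym (++-assoc (Θ (suc m)) _ _))
    (cleanCompact-++ (Θ (suc m)) (dotted (2 + m)) ((4 + m , e) ∷ []) ccΘ
      ((λ (p , _) → n≢1+m+n 0 (3 + m) (sym p)) , (λ (p , _) → n≢1+m+n 2 (2 + m) p) , tt))
  inner≡ : (Θ (suc m) ++ dotted (2 + m) ∷ []) ++ (4 + m , e) ∷ [] ≡ (suc m , d) ∷ ((r ++ dotted (2 + m) ∷ []) ++ (4 + m , e) ∷ [])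
  inner≡ = cong (λ w → (w ++ dotted (2 + m) ∷ []) ++ (4 + m , e) ∷ []) Θ≡

cleanCompact-Λ : ∀ m → CleanCompact (Λ m)
cleanCompact-Λ zero = tt
cleanCompact-Λ (suc zero) = tt
cleanCompact-Λ (suc (suc zero)) = (λ { (() , _) }) , (λ { (_ , inj₁ () , _) ; (_ , inj₂ () , _) }) , tt
cleanCompact-Λ (suc (suc (suc zero))) =
  (λ { (_ , inj₁ () , _) ; (_ , inj₂ () , _) }) , (λ { (() , _) }) , (λ { (() , _) }) , (λ { (() , _) }) , tt
cleanCompact-Λ (suc (suc (suc (suc m)))) with Λ-last (suc m) | cleanCompact-Λ (suc (suc m))
... | d , l , Λ≡ , _ | ccΛ = subst CleanCompact (sym split)
      (cleanCompact-++ (shift l) (2 , d) _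
        (subst CleanCompact (trans (cong shift Λ≡) (map-++ shiftEntry l _)) (cleanCompact-shift _ ccΛ))
        ((λ { (() , _) }) , (λ { (() , _) }) , (λ { (() , _) }) , (λ { (() , _) }) , tt))
  where
  split : shift (Λ (2 + m)) ++ dotted (4 + m) ∷ dotted 1 ∷ [] ≡ shift l ++ (2 , d) ∷ dotted (4 + m) ∷ dotted 1 ∷ []
  split = trans (cong (λ w → shift w ++ dotted (4 + m) ∷ dotted 1 ∷ []) Λ≡)
            (trans (cong (_++ dotted (4 + m) ∷ dotted 1 ∷ []) (map-++ shiftEntry l _)) (++-assoc (shift l) _ _))

cleanCompact-Λ-top : ∀ m e → CleanCompact (Λ (suc m) ++ (2 + m , e) ∷ [])
cleanCompact-Λ-top zero e = (λ { (_ , inj₁ () , _) ; (_ , inj₂ () , _) }) , (λ { (() , _) }) , tt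
cleanCompact-Λ-top (suc m) e with Λ-last (suc m)
... | d , l , Λ≡ , _ = subst CleanCompact (sym split)
      (cleanCompact-++ l (1 , d) _ (subst CleanCompact Λ≡ (cleanCompact-Λ (2 + m))) ((λ { (() , _) }) , (λ { (() , _) }) , tt))
  where
  split : Λ (2 + m) ++ (3 + m , e) ∷ [] ≡ l ++ (1 , d) ∷ (3 + m , e) ∷ []
  split = trans (cong (_++ (3 + m , e) ∷ []) Λ≡) (++-assoc l _ _)

double : ℕ → ℕ
double zero = zero
double (suc j) = suc (suc (double j))

⌊double/2⌋ : ∀ j → ⌊ double j /2⌋ ≡ j
⌊double/2⌋ zero = refl
⌊double/2⌋ (suc j) = cong suc (⌊double/2⌋ j)

⌊1+double/2⌋ : ∀ j → ⌊ suc (double j) /2⌋ ≡ j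
⌊1+double/2⌋ zero = refl
⌊1+double/2⌋ (suc j) = cong suc (⌊1+double/2⌋ j)

+-self≡double : ∀ j → j + j ≡ double j
+-self≡double zero = refl
+-self≡double (suc j) = cong suc (trans (+-suc j j) (cong suc (+-self≡double j)))

2*≡double : ∀ j → 2 * j ≡ double j
2*≡double j = trans (cong (j +_) (+-identityʳ j)) (+-self≡double j)

double-parity : ∀ k → (∃ λ j → k ≡ double j) ⊎ (∃ λ j → k ≡ suc (double j))
double-parity zero = inj₁ (0 , refl)
double-parity (suc k) with double-parity k
... | inj₁ (j , refl) = inj₂ (j , refl)
... | inj₂ (j , refl) = inj₁ (suc j , refl)

double%2 : ∀ j → double j % 2 ≡ 0
double%2 zero = refl
double%2 (suc j) = trans (cong (_% 2) (+-comm 2 (double j))) (trans ([m+n]%n≡m%n (double j) 2) (double%2 j))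

1+double%2 : ∀ j → suc (double j) % 2 ≡ 1
1+double%2 zero = refl
1+double%2 (suc j) = trans (cong (_% 2) (+-comm 2 (suc (double j)))) (trans ([m+n]%n≡m%n (suc (double j)) 2) (1+double%2 j))

allDot-∷ʳ : ∀ l v → allDot (l ++ v ∷ []) ≡ allDot l ++ dotted v ∷ []
allDot-∷ʳ l v = map-++ dotted l (v ∷ [])

allDot-map-suc : ∀ l → allDot (map suc l) ≡ shift (allDot l)
allDot-map-suc l = trans (sym (map-∘ l)) (map-∘ l)

thetaE : ℕ → Word
thetaE t = allDot (applyUpTo (λ i → 2 * (t ∸ i)) t) ++ (1 , plus) ∷ allDot (applyUpTo (λ i → 2 * i + 3) (t ∸ 1))

thetaO : ℕ → Word
thetaO s = allDot (applyUpTo (λ i → 2 * (s ∸ i) + 1) s) ++ (1 , minus) ∷ allDot (applyUpTo (λ i → 2 * i + 2) s)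

thetaE-Θ : ∀ j → thetaE (suc j) ≡ Θ (2 + double j)
thetaE-Θ zero = refl
thetaE-Θ (suc j) = begin
    dotted (2 * (2 + j)) ∷ (allDot A ++ (1 , plus) ∷ allDot (applyUpTo g (suc j)))
      ≡⟨ cong (λ l → dotted (2 * (2 + j)) ∷ (allDot A ++ (1 , plus) ∷ allDot l)) (sym (applyUpTo-∷ʳ g j)) ⟩
    dotted (2 * (2 + j)) ∷ (allDot A ++ (1 , plus) ∷ allDot (applyUpTo g j ++ g j ∷ []))
      ≡⟨ cong (λ l → dotted (2 * (2 + j)) ∷ (allDot A ++ (1 , plus) ∷ l)) (allDot-∷ʳ (applyUpTo g j) (g j)) ⟩
    dotted (2 * (2 + j)) ∷ (allDot A ++ (1 , plus) ∷ allDot (applyUpTo g j) ++ dotted (g j) ∷ [])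
      ≡⟨ cong (dotted (2 * (2 + j)) ∷_) (++-assoc (allDot A) _ _) ⟨
    dotted (2 * (2 + j)) ∷ (thetaE (suc j) ++ dotted (g j) ∷ [])
      ≡⟨ cong₂ (λ a w → dotted a ∷ w) (2*≡double (2 + j)) (cong₂ (λ w c → w ++ dotted c ∷ []) (thetaE-Θ j) g≡) ⟩
    dotted (4 + double j) ∷ (Θ (2 + double j) ++ dotted (3 + double j) ∷ []) ∎
  where
  open ≡-Reasoning
  A = applyUpTo (λ i → 2 * (suc j ∸ i)) (suc j)
  g : ℕ → ℕ
  g i = 2 * i + 3
  g≡ : g j ≡ 3 + double j
  g≡ = trans (+-comm (2 * j) 3) (cong (3 +_) (2*≡double j))

thetaO-Θ : ∀ j → thetaO j ≡ Θ (suc (double j))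
thetaO-Θ zero = refl
thetaO-Θ (suc j) = begin
    dotted (2 * suc j + 1) ∷ (allDot A ++ (1 , minus) ∷ allDot (applyUpTo g (suc j)))
      ≡⟨ cong (λ l → dotted (2 * suc j + 1) ∷ (allDot A ++ (1 , minus) ∷ allDot l)) (sym (applyUpTo-∷ʳ g j)) ⟩
    dotted (2 * suc j + 1) ∷ (allDot A ++ (1 , minus) ∷ allDot (applyUpTo g j ++ g j ∷ []))
      ≡⟨ cong (λ l → dotted (2 * suc j + 1) ∷ (allDot A ++ (1 , minus) ∷ l)) (allDot-∷ʳ (applyUpTo g j) (g j)) ⟩
    dotted (2 * suc j + 1) ∷ (allDot A ++ (1 , minus) ∷ allDot (applyUpTo g j) ++ dotted (g j) ∷ [])
      ≡⟨ cong (dotted (2 * suc j + 1) ∷_) (++-assoc (allDot A) _ _) ⟨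
    dotted (2 * suc j + 1) ∷ (thetaO j ++ dotted (g j) ∷ [])
      ≡⟨ cong₂ (λ a w → dotted a ∷ w) top≡ (cong₂ (λ w c → w ++ dotted c ∷ []) (thetaO-Θ j) g≡) ⟩
    dotted (3 + double j) ∷ (Θ (suc (double j)) ++ dotted (2 + double j) ∷ []) ∎
  where
  open ≡-Reasoning
  A = applyUpTo (λ i → 2 * (j ∸ i) + 1) j
  g : ℕ → ℕ
  g i = 2 * i + 2
  top≡ : 2 * suc j + 1 ≡ 3 + double j
  top≡ = trans (+-comm (2 * suc j) 1) (cong suc (2*≡double (suc j)))
  g≡ : g j ≡ 2 + double j
  g≡ = trans (+-comm (2 * j) 2) (cong (2 +_) (2*≡double j))

Thetae-Θ : ∀ j → Thetae (2 + double j) ≡ Θ (2 + double j)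
Thetae-Θ j = trans (cong (thetaE ∘ suc) (⌊double/2⌋ j)) (thetaE-Θ j)

Thetao-Θ : ∀ j → Thetao (3 + double j) ≡ Θ (3 + double j)
Thetao-Θ j = trans (cong (thetaO ∘ suc) (⌊1+double/2⌋ j)) (thetaO-Θ (suc j))

-- The value pairs of Λ_e (c = 0) and of Λ_o after its first entry (c = 1).
pairs : ℕ → ℕ → ℕ → List ℕ
pairs c t i = c + t + suc i ∷ t ∸ i ∷ []

concat-pairs-suc : ∀ c t → concat (applyUpTo (pairs c (suc t)) (suc t)) ≡ map suc (concat (applyUpTo (pairs c t) t)) ++ pairs c (suc t) t
concat-pairs-suc c t = begin
    concat (applyUpTo (pairs c (suc t)) (suc t))
      ≡⟨ cong concat (applyUpTo-∷ʳ (pairs c (suc t)) t) ⟨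
    concat (applyUpTo (pairs c (suc t)) t ++ pairs c (suc t) t ∷ [])
      ≡⟨ concat-++ (applyUpTo (pairs c (suc t)) t) (pairs c (suc t) t ∷ []) ⟨
    concat (applyUpTo (pairs c (suc t)) t) ++ pairs c (suc t) t ++ []
      ≡⟨ cong₂ (λ xss ys → concat xss ++ ys) shifted (++-identityʳ _) ⟩
    concat (map (map suc) (applyUpTo (pairs c t) t)) ++ pairs c (suc t) t
      ≡⟨ cong (_++ pairs c (suc t) t) (concat-map (applyUpTo (pairs c t) t)) ⟩
    map suc (concat (applyUpTo (pairs c t) t)) ++ pairs c (suc t) t ∎
  where
  open ≡-Reasoning
  applyUpTo-cong< : ∀ {f g : ℕ → List ℕ} n → (∀ i → i < n → f i ≡ g i) → applyUpTo f n ≡ applyUpTo g n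
  applyUpTo-cong< zero _ = refl
  applyUpTo-cong< (suc n) f≡g = cong₂ _∷_ (f≡g 0 (s≤s z≤n)) (applyUpTo-cong< n (λ i i<n → f≡g (suc i) (s≤s i<n)))
  shifted : applyUpTo (pairs c (suc t)) t ≡ map (map suc) (applyUpTo (pairs c t) t)
  shifted = trans (applyUpTo-cong< t (λ i i<t → cong₂ (λ a b → a ∷ b ∷ []) (cong (_+ suc i) (+-suc c t))
                                                  (+-∸-assoc 1 (<⇒≤ i<t))))
                  (sym (map-applyUpTo (pairs c t) (map suc) t))

pairs-last : ∀ c j → allDot (pairs c (suc j) j) ≡ dotted (c + double (suc j)) ∷ dotted 1 ∷ []
pairs-last c j = cong₂ (λ a b → dotted a ∷ dotted b ∷ [])
  (trans (+-assoc c (suc j) (suc j)) (cong (c +_) (+-self≡double (suc j))))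
  (m+n∸n≡m 1 j)

allDot-pairs-suc : ∀ c t → allDot (concat (applyUpTo (pairs c (suc t)) (suc t))) ≡
                           shift (allDot (concat (applyUpTo (pairs c t) t))) ++ dotted (c + double (suc t)) ∷ dotted 1 ∷ []
allDot-pairs-suc c t = begin
    allDot (concat (applyUpTo (pairs c (suc t)) (suc t)))    ≡⟨ cong allDot (concat-pairs-suc c t) ⟩
    allDot (map suc C ++ pairs c (suc t) t)                  ≡⟨ map-++ dotted (map suc C) _ ⟩
    allDot (map suc C) ++ allDot (pairs c (suc t) t)         ≡⟨ cong₂ _++_ (allDot-map-suc C) (pairs-last c t) ⟩
    shift (allDot C) ++ dotted (c + double (suc t)) ∷ dotted 1 ∷ [] ∎
  where
  open ≡-Reasoning
  C = concat (applyUpTo (pairs c t) t)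

lambdaE : ℕ → Word
lambdaE t = setHeadDeco plus (allDot (concat (applyUpTo (pairs 0 t) t)))

lambdaO : ℕ → Word
lambdaO s = (suc s , minus) ∷ allDot (concat (applyUpTo (pairs 1 s) s))

lambdaE-Λ : ∀ j → lambdaE (suc j) ≡ Λ (2 + double j)
lambdaE-Λ zero = refl
lambdaE-Λ (suc j) = begin
    setHeadDeco plus (allDot (concat (applyUpTo (pairs 0 (2 + j)) (2 + j))))
      ≡⟨ cong (setHeadDeco plus) (allDot-pairs-suc 0 (suc j)) ⟩
    setHeadDeco plus (shift (allDot (concat (applyUpTo (pairs 0 (suc j)) (suc j)))) ++ dotted (4 + double j) ∷ dotted 1 ∷ [])
      ≡⟨⟩
    shift (lambdaE (suc j)) ++ dotted (4 + double j) ∷ dotted 1 ∷ []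
      ≡⟨ cong (λ w → shift w ++ dotted (4 + double j) ∷ dotted 1 ∷ []) (lambdaE-Λ j) ⟩
    Λ (4 + double j) ∎
  where open ≡-Reasoning

lambdaO-Λ : ∀ j → lambdaO j ≡ Λ (suc (double j))
lambdaO-Λ zero = refl
lambdaO-Λ (suc j) = begin
    (2 + j , minus) ∷ allDot (concat (applyUpTo (pairs 1 (suc j)) (suc j)))
      ≡⟨ cong ((2 + j , minus) ∷_) (allDot-pairs-suc 1 j) ⟩
    shift (lambdaO j) ++ dotted (3 + double j) ∷ dotted 1 ∷ []
      ≡⟨ cong (λ w → shift w ++ dotted (3 + double j) ∷ dotted 1 ∷ []) (lambdaO-Λ j) ⟩
    Λ (3 + double j) ∎
  where open ≡-Reasoning

Lambdae-Λ : ∀ j → Lambdae (2 + double j) ≡ Λ (2 + double j)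
Lambdae-Λ j = trans (cong (lambdaE ∘ suc) (⌊double/2⌋ j)) (lambdaE-Λ j)

Lambdao-Λ : ∀ j → Lambdao (3 + double j) ≡ Λ (3 + double j)
Lambdao-Λ j = trans (cong (lambdaO ∘ suc) (⌊1+double/2⌋ j)) (lambdaO-Λ (suc j))

-- Patterns as order-preserving position maps

-- Positions are counted from 0; out of range the junk entry (0 , dot) is returned, so every use is guarded by a bound.
entryAt : Word → ℕ → ℕ × Deco
entryAt [] i = (0 , dot)
entryAt (x ∷ w) zero = x
entryAt (x ∷ w) (suc i) = entryAt w i

valueAt : Word → ℕ → ℕ
valueAt w i = proj₁ (entryAt w i)

decoAt : Word → ℕ → Deco
decoAt w i = proj₂ (entryAt w i)

lookup≡entryAt : ∀ w (i : Fin (length w)) → List.lookup w i ≡ entryAt w (toℕ i)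
lookup≡entryAt (x ∷ w) Fin.zero = refl
lookup≡entryAt (x ∷ w) (Fin.suc i) = lookup≡entryAt w i

entryAt-++ˡ : ∀ u v i → i < length u → entryAt (u ++ v) i ≡ entryAt u i
entryAt-++ˡ (x ∷ u) v zero _ = refl
entryAt-++ˡ (x ∷ u) v (suc i) (s≤s i<n) = entryAt-++ˡ u v i i<n

entryAt-length : ∀ u x v → entryAt (u ++ x ∷ v) (length u) ≡ x
entryAt-length [] x v = refl
entryAt-length (y ∷ u) x v = entryAt-length u x v

entryAt-suc-length : ∀ u x y v → entryAt (u ++ x ∷ y ∷ v) (suc (length u)) ≡ y
entryAt-suc-length [] x y v = refl
entryAt-suc-length (z ∷ u) x y v = entryAt-suc-length u x y v

entryAt-shift : ∀ w i → i < length w → entryAt (shift w) i ≡ shiftEntry (entryAt w i)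
entryAt-shift (x ∷ w) zero _ = refl
entryAt-shift (x ∷ w) (suc i) (s≤s i<n) = entryAt-shift w i i<n

valueAt-∈ : ∀ w i → i < length w → valueAt w i ∈ values w
valueAt-∈ (x ∷ w) zero _ = here refl
valueAt-∈ (x ∷ w) (suc i) (s≤s i<n) = there (valueAt-∈ w i i<n)

∈⇒valueAt : ∀ w {v} → v ∈ values w → ∃ λ i → i < length w × valueAt w i ≡ v
∈⇒valueAt (x ∷ w) (here refl) = 0 , s≤s z≤n , refl
∈⇒valueAt (x ∷ w) (there v∈) with i , i<n , eq ← ∈⇒valueAt w v∈ = suc i , s≤s i<n , eq

valueAt-bounds : ∀ σ → IsPegPerm σ → ∀ i → i < length σ → 1 ≤ valueAt σ i × valueAt σ i ≤ length σ
valueAt-bounds σ π i i<n with ∈-applyUpTo⁻ suc (Perm.∈-resp-↭ π (valueAt-∈ σ i i<n))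
... | k , k<n , v≡ = subst (1 ≤_) (sym v≡) (s≤s z≤n) , subst (_≤ length σ) (sym v≡) k<n

valueAt-surjective : ∀ σ → IsPegPerm σ → ∀ v → 1 ≤ v → v ≤ length σ → ∃ λ i → i < length σ × valueAt σ i ≡ v
valueAt-surjective σ π (suc v) _ v≤n = ∈⇒valueAt σ (Perm.∈-resp-↭ (↭-sym π) (∈-applyUpTo⁺ suc v≤n))

record Embedding (σ w : Word) : Set where
  field
    pos : ℕ → ℕ
    pos< : ∀ p → p < length σ → pos p < length w
    pos-mono : ∀ p q → p < q → q < length σ → pos p < pos q
    order→ : ∀ p q → p < length σ → q < length σ → valueAt σ p < valueAt σ q → valueAt w (pos p) < valueAt w (pos q)
    order← : ∀ p q → p < length σ → q < length σ → valueAt w (pos p) < valueAt w (pos q) → valueAt σ p < valueAt σ q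
    decoCompat : ∀ p → p < length σ → DecoCompat (decoAt σ p) (decoAt w (pos p))

isPattern⇒embedding : ∀ σ w → IsPattern σ w → Embedding σ w
isPattern⇒embedding σ w (f , f-mono , f-order , f-deco) = record
  { pos = pos ; pos< = pos< ; pos-mono = pos-mono ; order→ = order→ ; order← = order← ; decoCompat = decoCompat }
  where
  pos : ℕ → ℕ
  pos p with p <? length σ
  ... | yes p<n = toℕ (f (fromℕ< p<n))
  ... | no _ = 0
  pos≡ : ∀ p (p<n : p < length σ) → pos p ≡ toℕ (f (fromℕ< p<n))
  pos≡ p p<n with p <? length σ
  ... | yes _ = refl
  ... | no p≮n = contradiction p<n p≮n
  entryσ : ∀ p (p<n : p < length σ) → List.lookup σ (fromℕ< p<n) ≡ entryAt σ p
  entryσ p p<n = trans (lookup≡entryAt σ (fromℕ< p<n)) (cong (entryAt σ) (Fin.toℕ-fromℕ< p<n))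
  entryw : ∀ p (p<n : p < length σ) → List.lookup w (f (fromℕ< p<n)) ≡ entryAt w (pos p)
  entryw p p<n = trans (lookup≡entryAt w (f (fromℕ< p<n))) (cong (entryAt w) (sym (pos≡ p p<n)))
  pos< : ∀ p → p < length σ → pos p < length w
  pos< p p<n = subst (_< length w) (sym (pos≡ p p<n)) (Fin.toℕ<n (f (fromℕ< p<n)))
  pos-mono : ∀ p q → p < q → q < length σ → pos p < pos q
  pos-mono p q p<q q<n = subst₂ _<_ (sym (pos≡ p p<n)) (sym (pos≡ q q<n))
    (f-mono (fromℕ< p<n) (fromℕ< q<n) (subst₂ _<_ (sym (Fin.toℕ-fromℕ< p<n)) (sym (Fin.toℕ-fromℕ< q<n)) p<q))
    where p<n = <-trans p<q q<n
  order→ : ∀ p q → p < length σ → q < length σ → valueAt σ p < valueAt σ q → valueAt w (pos p) < valueAt w (pos q)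
  order→ p q p<n q<n lt = subst₂ _<_ (cong proj₁ (entryw p p<n)) (cong proj₁ (entryw q q<n))
    (proj₁ (f-order (fromℕ< p<n) (fromℕ< q<n))
      (subst₂ _<_ (cong proj₁ (sym (entryσ p p<n))) (cong proj₁ (sym (entryσ q q<n))) lt))
  order← : ∀ p q → p < length σ → q < length σ → valueAt w (pos p) < valueAt w (pos q) → valueAt σ p < valueAt σ q
  order← p q p<n q<n lt = subst₂ _<_ (cong proj₁ (entryσ p p<n)) (cong proj₁ (entryσ q q<n))
    (proj₂ (f-order (fromℕ< p<n) (fromℕ< q<n))
      (subst₂ _<_ (cong proj₁ (sym (entryw p p<n))) (cong proj₁ (sym (entryw q q<n))) lt))
  decoCompat : ∀ p → p < length σ → DecoCompat (decoAt σ p) (decoAt w (pos p))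
  decoCompat p p<n = subst₂ DecoCompat (cong proj₂ (entryσ p p<n)) (cong proj₂ (entryw p p<n)) (f-deco (fromℕ< p<n))

module _ {σ w : Word} (E : Embedding σ w) where
  open Embedding E

  pos-≥ : ∀ p → p < length σ → p ≤ pos p
  pos-≥ zero _ = z≤n
  pos-≥ (suc p) p<n = <-≤-trans (s≤s (pos-≥ p (<-trans (n<1+n p) p<n))) (pos-mono p (suc p) (n<1+n p) p<n)

  embedding-length-≤ : length σ ≤ length w
  embedding-length-≤ with length σ in eq
  ... | zero = z≤n
  ... | suc m = ≤-trans (s≤s (pos-≥ m m<n)) (pos< m m<n)
    where m<n = subst (m <_) (sym eq) (n<1+n m)

  pos≡0 : ∀ p → p < length σ → pos p ≡ 0 → p ≡ 0
  pos≡0 zero _ _ = refl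
  pos≡0 (suc p) p<n pos≡ = contradiction (pos-mono 0 (suc p) (s≤s z≤n) p<n) (λ lt → <⇒≱ lt (≤-trans (≤-reflexive pos≡) z≤n))

-- Shapes of Θ and Λ inherited by their patterns

VShaped : Word → Set
VShaped σ = ∀ p → p < length σ →
  (∀ q → q < p → valueAt σ p < valueAt σ q) ⊎ (∀ q → p < q → q < length σ → valueAt σ p < valueAt σ q)

Spiral : Word → Set
Spiral σ = ∀ p → p < length σ →
  (∀ q → q < p → valueAt σ q < valueAt σ p) ⊎ (∀ q → q < p → valueAt σ p < valueAt σ q)

MarkedAtOne : Deco → Word → Set
MarkedAtOne D σ = ∀ p → p < length σ → decoAt σ p ≡ dot ⊎ (valueAt σ p ≡ 1 × decoAt σ p ≡ D)

MarkedAtHead : Deco → Word → Set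
MarkedAtHead D σ = ∀ p → p < length σ → decoAt σ p ≡ dot ⊎ (p ≡ 0 × decoAt σ p ≡ D)

parityDeco : ℕ → Deco
parityDeco zero = plus
parityDeco (suc n) = flipDeco (parityDeco n)

parityDeco-2+ : ∀ n → parityDeco (2 + n) ≡ parityDeco n
parityDeco-2+ n = flipDeco-involutive (parityDeco n)

parityDeco≢dot : ∀ n → parityDeco n ≢ dot
parityDeco≢dot zero ()
parityDeco≢dot (suc n) = parityDeco≢dot n ∘ flipDeco≡dot (parityDeco n)
  where
  flipDeco≡dot : ∀ d → flipDeco d ≡ dot → d ≡ dot
  flipDeco≡dot dot _ = refl

parityDeco-suc≢ : ∀ n → parityDeco (suc n) ≢ parityDeco n
parityDeco-suc≢ n = flipDeco≢ (parityDeco n) (parityDeco≢dot n)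
  where
  flipDeco≢ : ∀ d → d ≢ dot → flipDeco d ≢ d
  flipDeco≢ dot d≢dot _ = d≢dot refl

decoCompat⇒≡ : ∀ d e → DecoCompat d e → d ≡ dot ⊎ d ≡ e
decoCompat⇒≡ plus e e≡ = inj₂ (sym e≡)
decoCompat⇒≡ minus e e≡ = inj₂ (sym e≡)
decoCompat⇒≡ dot e _ = inj₁ refl

module _ {σ w : Word} (E : Embedding σ w) where
  open Embedding E

  vShaped-embedding : VShaped w → VShaped σ
  vShaped-embedding V p p<n with V (pos p) (pos< p p<n)
  ... | inj₁ left = inj₁ λ q q<p → order← p q p<n (<-trans q<p p<n) (left (pos q) (pos-mono q p q<p p<n))
  ... | inj₂ right = inj₂ λ q p<q q<n → order← p q p<n q<n (right (pos q) (pos-mono p q p<q q<n) (pos< q q<n))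

  spiral-embedding : Spiral w → Spiral σ
  spiral-embedding S p p<n with S (pos p) (pos< p p<n)
  ... | inj₁ max = inj₁ λ q q<p → order← q p (<-trans q<p p<n) p<n (max (pos q) (pos-mono q p q<p p<n))
  ... | inj₂ min = inj₂ λ q q<p → order← p q p<n (<-trans q<p p<n) (min (pos q) (pos-mono q p q<p p<n))

  markedAtHead-embedding : ∀ D → MarkedAtHead D w → MarkedAtHead D σ
  markedAtHead-embedding D M p p<n with decoCompat⇒≡ _ _ (decoCompat p p<n) | M (pos p) (pos< p p<n)
  ... | inj₁ σ-dot | _ = inj₁ σ-dot
  ... | inj₂ same | inj₁ w-dot = inj₁ (trans same w-dot)
  ... | inj₂ same | inj₂ (pos≡ , w-D) = inj₂ (pos≡0 E p p<n pos≡ , trans same w-D)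

  markedAtOne-embedding : ∀ D → IsPegPerm σ → (∀ i → i < length w → 1 ≤ valueAt w i) →
                          MarkedAtOne D w → MarkedAtOne D σ
  markedAtOne-embedding D π w-pos M p p<n with decoCompat⇒≡ _ _ (decoCompat p p<n) | M (pos p) (pos< p p<n)
  ... | inj₁ σ-dot | _ = inj₁ σ-dot
  ... | inj₂ same | inj₁ w-dot = inj₁ (trans same w-dot)
  ... | inj₂ same | inj₂ (w-one , w-D) = inj₂ (σ-one w-one , trans same w-D)
    where
    -- The entry 1 of σ sits below σ p, so its image would sit below the entry 1 of w.
    σ-one : valueAt w (pos p) ≡ 1 → valueAt σ p ≡ 1
    σ-one w-one with valueAt σ p ≟ 1
    ... | yes one = one
    ... | no ¬one with r , r<n , r-one ← valueAt-surjective σ π 1 (s≤s z≤n) (≤-trans (s≤s z≤n) p<n) =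
      contradiction (w-pos (pos r) (pos< r r<n))
        (<⇒≱ (subst (valueAt w (pos r) <_) w-one
          (order→ r p r<n p<n (subst (_< valueAt σ p) (sym r-one)
            (≤∧≢⇒< (proj₁ (valueAt-bounds σ π p p<n)) (¬one ∘ sym))))))

valueAt-Θ-bounds : ∀ m i → i < m → 1 ≤ valueAt (Θ m) i × valueAt (Θ m) i ≤ m
valueAt-Θ-bounds m i i<m = subst (λ n → 1 ≤ valueAt (Θ m) i × valueAt (Θ m) i ≤ n) (length-Θ m)
  (valueAt-bounds (Θ m) (isPegPerm-Θ m) i (subst (i <_) (sym (length-Θ m)) i<m))

valueAt-Λ-bounds : ∀ m i → i < m → 1 ≤ valueAt (Λ m) i × valueAt (Λ m) i ≤ m
valueAt-Λ-bounds m i i<m = subst (λ n → 1 ≤ valueAt (Λ m) i × valueAt (Λ m) i ≤ n) (length-Λ m)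
  (valueAt-bounds (Λ m) (isPegPerm-Λ m) i (subst (i <_) (sym (length-Λ m)) i<m))

module Θ-entries (m : ℕ) where
  entryAt-inner : ∀ i → i < suc m → entryAt (Θ (3 + m)) (suc i) ≡ entryAt (Θ (suc m)) i
  entryAt-inner i i<n = entryAt-++ˡ (Θ (suc m)) _ i (subst (i <_) (sym (length-Θ (suc m))) i<n)

  entryAt-last : entryAt (Θ (3 + m)) (2 + m) ≡ dotted (2 + m)
  entryAt-last = subst (λ n → entryAt (Θ (suc m) ++ dotted (2 + m) ∷ []) n ≡ dotted (2 + m)) (length-Θ (suc m))
    (entryAt-length (Θ (suc m)) _ [])

  position-cases : ∀ p → suc p < length (Θ (3 + m)) → p < suc m ⊎ p ≡ suc m
  position-cases p p<n = m<1+n⇒m<n∨m≡n (≤-pred (subst (suc p <_) (length-Θ (3 + m)) p<n))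

vShaped-Θ : ∀ m → VShaped (Θ m)
vShaped-Θ zero p ()
vShaped-Θ (suc zero) zero _ = inj₁ λ q ()
vShaped-Θ (suc zero) (suc p) (s≤s ())
vShaped-Θ (suc (suc zero)) zero _ = inj₁ λ q ()
vShaped-Θ (suc (suc zero)) (suc zero) _ = inj₂ λ { q (s≤s (s≤s _)) (s≤s (s≤s ())) }
vShaped-Θ (suc (suc zero)) (suc (suc p)) (s≤s (s≤s ()))
vShaped-Θ (suc (suc (suc m))) zero _ = inj₁ λ q ()
vShaped-Θ (suc (suc (suc m))) (suc p) p<n with position-cases p p<n
  where open Θ-entries m
... | inj₂ refl = inj₂ λ q p<q q<n → contradiction (≤-pred (subst (q <_) (length-Θ (3 + m)) q<n)) (<⇒≱ p<q)
... | inj₁ p<m with vShaped-Θ (suc m) p (subst (p <_) (sym (length-Θ (suc m))) p<m)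
...   | inj₁ left = inj₁ earlier
  where
  open Θ-entries m
  value≡ = cong proj₁ (entryAt-inner p p<m)
  earlier : ∀ q → q < suc p → valueAt (Θ (3 + m)) (suc p) < valueAt (Θ (3 + m)) q
  earlier zero _ = subst (_< 3 + m) (sym value≡) (s≤s (m≤n⇒m≤1+n (proj₂ (valueAt-Θ-bounds (suc m) p p<m))))
  earlier (suc q) (s≤s q<p) = subst₂ _<_ (sym value≡) (sym (cong proj₁ (entryAt-inner q (<-trans q<p p<m)))) (left q q<p)
...   | inj₂ right = inj₂ later
  where
  open Θ-entries m
  value≡ = cong proj₁ (entryAt-inner p p<m)
  later : ∀ q → suc p < q → q < length (Θ (3 + m)) → valueAt (Θ (3 + m)) (suc p) < valueAt (Θ (3 + m)) q
  later (suc q) (s≤s p<q) q<n with position-cases q q<n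
  ... | inj₁ q<m = subst₂ _<_ (sym value≡) (sym (cong proj₁ (entryAt-inner q q<m)))
                     (right q p<q (subst (q <_) (sym (length-Θ (suc m))) q<m))
  ... | inj₂ refl = subst₂ _<_ (sym value≡) (sym (cong proj₁ entryAt-last)) (s≤s (proj₂ (valueAt-Θ-bounds (suc m) p p<m)))

markedAtOne-Θ : ∀ m → MarkedAtOne (parityDeco m) (Θ m)
markedAtOne-Θ zero p ()
markedAtOne-Θ (suc zero) zero _ = inj₂ (refl , refl)
markedAtOne-Θ (suc zero) (suc p) (s≤s ())
markedAtOne-Θ (suc (suc zero)) zero _ = inj₁ refl
markedAtOne-Θ (suc (suc zero)) (suc zero) _ = inj₂ (refl , refl)
markedAtOne-Θ (suc (suc zero)) (suc (suc p)) (s≤s (s≤s ()))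
markedAtOne-Θ (suc (suc (suc m))) zero _ = inj₁ refl
markedAtOne-Θ (suc (suc (suc m))) (suc p) p<n with Θ-entries.position-cases m p p<n
... | inj₂ refl = inj₁ (cong proj₂ (Θ-entries.entryAt-last m))
... | inj₁ p<m with markedAtOne-Θ (suc m) p (subst (p <_) (sym (length-Θ (suc m))) p<m)
...   | inj₁ dot≡ = inj₁ (trans (cong proj₂ (Θ-entries.entryAt-inner m p p<m)) dot≡)
...   | inj₂ (one , D≡) = inj₂ (trans (cong proj₁ (Θ-entries.entryAt-inner m p p<m)) one ,
                               trans (cong proj₂ (Θ-entries.entryAt-inner m p p<m)) (trans D≡ (sym (parityDeco-2+ (suc m)))))

module Λ-entries (m : ℕ) where
  length-inner : length (shift (Λ (suc m))) ≡ suc m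
  length-inner = trans (length-shift (Λ (suc m))) (length-Λ (suc m))

  entryAt-inner : ∀ i → i < suc m → entryAt (Λ (3 + m)) i ≡ shiftEntry (entryAt (Λ (suc m)) i)
  entryAt-inner i i<n = trans (entryAt-++ˡ (shift (Λ (suc m))) _ i (subst (i <_) (sym length-inner) i<n))
                              (entryAt-shift (Λ (suc m)) i (subst (i <_) (sym (length-Λ (suc m))) i<n))

  entryAt-top : entryAt (Λ (3 + m)) (suc m) ≡ dotted (3 + m)
  entryAt-top = subst (λ n → entryAt (Λ (3 + m)) n ≡ dotted (3 + m)) length-inner (entryAt-length (shift (Λ (suc m))) _ _)

  entryAt-bottom : entryAt (Λ (3 + m)) (2 + m) ≡ dotted 1
  entryAt-bottom = subst (λ n → entryAt (Λ (3 + m)) (suc n) ≡ dotted 1) length-inner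
    (entryAt-suc-length (shift (Λ (suc m))) (dotted (3 + m)) (dotted 1) [])

  position-cases : ∀ p → p < length (Λ (3 + m)) → p < suc m ⊎ p ≡ suc m ⊎ p ≡ 2 + m
  position-cases p p<n with m<1+n⇒m<n∨m≡n (subst (p <_) (length-Λ (3 + m)) p<n)
  ... | inj₂ p≡ = inj₂ (inj₂ p≡)
  ... | inj₁ p<2+m with m<1+n⇒m<n∨m≡n p<2+m
  ...   | inj₁ p<m = inj₁ p<m
  ...   | inj₂ p≡ = inj₂ (inj₁ p≡)

spiral-Λ-step : ∀ m → Spiral (Λ (suc m)) → Spiral (Λ (3 + m))
spiral-Λ-step m S p p<n with position-cases p p<n
  where open Λ-entries m
... | inj₂ (inj₂ refl) = inj₂ bottom
  where
  open Λ-entries m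
  bottom : ∀ q → q < 2 + m → valueAt (Λ (3 + m)) (2 + m) < valueAt (Λ (3 + m)) q
  bottom q q<n with m<1+n⇒m<n∨m≡n q<n
  ... | inj₁ q<m = subst₂ _<_ (sym (cong proj₁ entryAt-bottom)) (sym (cong proj₁ (entryAt-inner q q<m)))
                     (s≤s (proj₁ (valueAt-Λ-bounds (suc m) q q<m)))
  ... | inj₂ refl = subst₂ _<_ (sym (cong proj₁ entryAt-bottom)) (sym (cong proj₁ entryAt-top)) (s≤s (s≤s z≤n))
... | inj₂ (inj₁ refl) = inj₁ λ q q<m →
  subst₂ _<_ (sym (cong proj₁ (entryAt-inner q q<m))) (sym (cong proj₁ entryAt-top))
    (s≤s (s≤s (proj₂ (valueAt-Λ-bounds (suc m) q q<m))))
  where open Λ-entries m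
... | inj₁ p<m with S p (subst (p <_) (sym (length-Λ (suc m))) p<m)
...   | inj₁ max = inj₁ λ q q<p →
  subst₂ _<_ (sym (cong proj₁ (entryAt-inner q (<-trans q<p p<m)))) (sym (cong proj₁ (entryAt-inner p p<m))) (s≤s (max q q<p))
  where open Λ-entries m
...   | inj₂ min = inj₂ λ q q<p →
  subst₂ _<_ (sym (cong proj₁ (entryAt-inner p p<m))) (sym (cong proj₁ (entryAt-inner q (<-trans q<p p<m)))) (s≤s (min q q<p))
  where open Λ-entries m

spiral-Λ : ∀ m → Spiral (Λ m)
spiral-Λ zero p ()
spiral-Λ (suc zero) zero _ = inj₁ λ q ()
spiral-Λ (suc zero) (suc p) (s≤s ())
spiral-Λ (suc (suc zero)) zero _ = inj₁ λ q ()
spiral-Λ (suc (suc zero)) (suc zero) _ = inj₂ λ { zero _ → s≤s (s≤s z≤n) ; (suc q) (s≤s ()) }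
spiral-Λ (suc (suc zero)) (suc (suc p)) (s≤s (s≤s ()))
spiral-Λ (suc (suc (suc m))) = spiral-Λ-step m (spiral-Λ (suc m))

markedAtHead-Λ-step : ∀ m → MarkedAtHead (parityDeco (suc m)) (Λ (suc m)) → MarkedAtHead (parityDeco (3 + m)) (Λ (3 + m))
markedAtHead-Λ-step m M p p<n with Λ-entries.position-cases m p p<n
... | inj₂ (inj₂ refl) = inj₁ (cong proj₂ (Λ-entries.entryAt-bottom m))
... | inj₂ (inj₁ refl) = inj₁ (cong proj₂ (Λ-entries.entryAt-top m))
... | inj₁ p<m with M p (subst (p <_) (sym (length-Λ (suc m))) p<m)
...   | inj₁ dot≡ = inj₁ (trans (cong proj₂ (Λ-entries.entryAt-inner m p p<m)) dot≡)
...   | inj₂ (p≡0 , D≡) = inj₂ (p≡0 , trans (cong proj₂ (Λ-entries.entryAt-inner m p p<m))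
                                              (trans D≡ (sym (parityDeco-2+ (suc m)))))

markedAtHead-Λ : ∀ m → MarkedAtHead (parityDeco m) (Λ m)
markedAtHead-Λ zero p ()
markedAtHead-Λ (suc zero) zero _ = inj₂ (refl , refl)
markedAtHead-Λ (suc zero) (suc p) (s≤s ())
markedAtHead-Λ (suc (suc zero)) zero _ = inj₂ (refl , refl)
markedAtHead-Λ (suc (suc zero)) (suc zero) _ = inj₁ refl
markedAtHead-Λ (suc (suc zero)) (suc (suc p)) (s≤s (s≤s ()))
markedAtHead-Λ (suc (suc (suc m))) = markedAtHead-Λ-step m (markedAtHead-Λ (suc m))

-- Classification of the clean compact patterns of Θ and Λ

decoCompat-refl : ∀ d → DecoCompat d d
decoCompat-refl plus = refl
decoCompat-refl minus = refl
decoCompat-refl dot = tt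

embedding-by-offset : ∀ {σ w} k (pos : ℕ → ℕ) → (∀ p → p < length σ → pos p < length w) → (∀ p q → p < q → pos p < pos q) →
                      (∀ p → p < length σ → entryAt w (pos p) ≡ (k + valueAt σ p , decoAt σ p)) → Embedding σ w
embedding-by-offset {σ} {w} k pos pos< pos-mono entry≡ = record
  { pos = pos ; pos< = pos< ; pos-mono = λ p q p<q _ → pos-mono p q p<q
  ; order→ = λ p q p<n q<n lt → subst₂ _<_ (sym (value≡ p p<n)) (sym (value≡ q q<n)) (+-monoʳ-< k lt)
  ; order← = λ p q p<n q<n lt → +-cancelˡ-< k _ _ (subst₂ _<_ (value≡ p p<n) (value≡ q q<n) lt)
  ; decoCompat = λ p p<n → subst (DecoCompat (decoAt σ p)) (sym (cong proj₂ (entry≡ p p<n))) (decoCompat-refl _)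
  }
  where
  value≡ : ∀ p → p < length σ → valueAt w (pos p) ≡ k + valueAt σ p
  value≡ p p<n = cong proj₁ (entry≡ p p<n)

<length-∷ʳ : ∀ (τ : Word) x {i} → i < length τ → i < length (τ ++ x ∷ [])
<length-∷ʳ τ x i<n = ≤-trans i<n (≤-trans (n≤1+n _) (≤-reflexive (sym (length-∷ʳ τ x))))

tail-embedding : ∀ x τ → Embedding τ (x ∷ τ)
tail-embedding x τ = embedding-by-offset 0 suc (λ _ → s≤s) (λ _ _ → s≤s) (λ _ _ → refl)

init-embedding : ∀ τ x → Embedding τ (τ ++ x ∷ [])
init-embedding τ x = embedding-by-offset 0 Function.id (λ _ → <length-∷ʳ τ x) (λ _ _ → Function.id)
  (λ p p<n → entryAt-++ˡ τ _ p p<n)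

shift-init-embedding : ∀ τ x → Embedding τ (shift τ ++ x ∷ [])
shift-init-embedding τ x = embedding-by-offset 1 Function.id
  (λ p p<n → <length-∷ʳ (shift τ) x (subst (p <_) (sym (length-shift τ)) p<n))
  (λ _ _ → Function.id)
  (λ p p<n → trans (entryAt-++ˡ (shift τ) _ p (subst (p <_) (sym (length-shift τ)) p<n)) (entryAt-shift τ p p<n))

∷ʳ-view : ∀ (σ : Word) m → length σ ≡ suc m → ∃₂ λ τ x → σ ≡ τ ++ x ∷ [] × length τ ≡ m
∷ʳ-view (y ∷ []) zero refl = [] , y , refl , refl
∷ʳ-view (y ∷ z ∷ σ) (suc m) len with τ , x , σ≡ , len′ ← ∷ʳ-view (z ∷ σ) m (suc-injective len) =
  y ∷ τ , x , cong (y ∷_) σ≡ , cong suc len′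

isIdentity-cleanCompact : ∀ τ → IsIdentity τ → CleanCompact τ → 1 ≤ length τ → ∃ λ d → τ ≡ (1 , d) ∷ [] × PlusOrDot d
isIdentity-cleanCompact ((v , d) ∷ []) (vs , d⁺ ∷ []) _ _ with refl , _ ← ∷-injective vs = d , refl , d⁺
isIdentity-cleanCompact ((v , d) ∷ (v′ , d′) ∷ τ) (vs , d⁺ ∷ d′⁺ ∷ _) (¬inc , _) _
  with refl , vs′ ← ∷-injective vs with refl , _ ← ∷-injective vs′ = contradiction (refl , d⁺ , d′⁺) ¬inc

isPegPerm-tail : ∀ x τ → proj₁ x ≡ suc (length τ) → IsPegPerm (x ∷ τ) → IsPegPerm τ
isPegPerm-tail (v , d) τ refl π = subst (values τ ↭_) (++-identityʳ _)
  (Perm.drop-mid [] (applyUpTo suc (length τ)) (subst (v ∷ values τ ↭_) (sym (applyUpTo-∷ʳ suc (length τ))) π))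

isPegPerm-init : ∀ τ x → proj₁ x ≡ suc (length τ) → IsPegPerm (τ ++ x ∷ []) → IsPegPerm τ
isPegPerm-init τ (v , d) refl π = subst₂ _↭_ (++-identityʳ _) (++-identityʳ _)
  (Perm.drop-mid (values τ) (applyUpTo suc (length τ))
    (subst₂ _↭_ (values-∷ʳ τ v d) (trans (cong (applyUpTo suc) (length-∷ʳ τ _)) (sym (applyUpTo-∷ʳ suc (length τ)))) π))

unshift : Word → Word
unshift = map (λ (v , d) → (pred v , d))

isPegPerm-init-min : ∀ τ x → proj₁ x ≡ 1 → IsPegPerm (τ ++ x ∷ []) → ∃ λ τ′ → shift τ′ ≡ τ × IsPegPerm τ′
isPegPerm-init-min τ (v , d) refl π = unshift τ , shift-unshift τ positive , subst₂ _↭_ values≡ range≡ (Perm.map⁺ pred values-τ)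
  where
  values-τ : values τ ↭ applyUpTo (suc ∘ suc) (length τ)
  values-τ = subst (_↭ applyUpTo (suc ∘ suc) (length τ)) (++-identityʳ _)
    (Perm.drop-mid (values τ) [] (subst₂ _↭_ (values-∷ʳ τ 1 d) (cong (applyUpTo suc) (length-∷ʳ τ _)) π))
  positive : ∀ u → u ∈ values τ → 1 ≤ u
  positive u u∈ with i , _ , u≡ ← ∈-applyUpTo⁻ (suc ∘ suc) (Perm.∈-resp-↭ values-τ u∈) = subst (1 ≤_) (sym u≡) (s≤s z≤n)
  shift-unshift : ∀ τ → (∀ u → u ∈ values τ → 1 ≤ u) → shift (unshift τ) ≡ τ
  shift-unshift [] _ = refl
  shift-unshift ((zero , d) ∷ τ) pos with () ← pos 0 (here refl)
  shift-unshift ((suc u , d) ∷ τ) pos = cong ((suc u , d) ∷_) (shift-unshift τ (λ u u∈ → pos u (there u∈)))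
  values≡ : map pred (values τ) ≡ values (unshift τ)
  values≡ = trans (sym (map-∘ τ)) (map-∘ τ)
  range≡ : map pred (applyUpTo (suc ∘ suc) (length τ)) ≡ applyUpTo suc (length (unshift τ))
  range≡ = trans (map-applyUpTo (suc ∘ suc) pred (length τ)) (cong (applyUpTo suc) (sym (length-map _ τ)))

valueAt-positive : ∀ w → IsPegPerm w → ∀ i → i < length w → 1 ≤ valueAt w i
valueAt-positive w π i i<n = proj₁ (valueAt-bounds w π i i<n)

FamilyOrIdentity : (ℕ → Word) → Deco → Word → Set
FamilyOrIdentity F D σ = IsIdentity σ ⊎ ∃ λ j → parityDeco j ≡ D × (σ ≡ F j ⊎ σ ≡ F j ++ dotted (suc j) ∷ [])

familyOrIdentity-singleton : ∀ F D → F 1 ≡ (1 , minus) ∷ [] → ∀ x → IsPegPerm (x ∷ []) →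
                             proj₂ x ≡ dot ⊎ proj₂ x ≡ D → FamilyOrIdentity F D (x ∷ [])
familyOrIdentity-singleton F D F1 (v , d) π marked
  with lo , hi ← valueAt-bounds ((v , d) ∷ []) π 0 (s≤s z≤n) with refl ← ≤-antisym hi lo with d | marked
... | plus | _ = inj₁ (refl , inj₁ refl ∷ [])
... | dot | _ = inj₁ (refl , inj₂ refl ∷ [])
... | minus | inj₂ minus≡D = inj₂ (1 , minus≡D , inj₁ (sym F1))

-- Appending the maximum to an identity or to F j ++ [j + 1] would extend an increasing strip.
familyOrIdentity-appendMax : ∀ F → (∀ j → length (F j) ≡ j) → ∀ D m τ → length τ ≡ suc m →
  CleanCompact (τ ++ dotted (2 + m) ∷ []) → FamilyOrIdentity F D τ → FamilyOrIdentity F D (τ ++ dotted (2 + m) ∷ [])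
familyOrIdentity-appendMax F length-F D m τ len cc (inj₁ isId)
  with d , refl , d⁺ ← isIdentity-cleanCompact τ isId (cleanCompact-init τ _ cc) (subst (1 ≤_) (sym len) (s≤s z≤n)) =
  contradiction (cong (suc ∘ suc) (sym (suc-injective len)) , d⁺ , inj₂ refl) (proj₁ cc)
familyOrIdentity-appendMax F length-F D m .(F j) len cc (inj₂ (j , j-D , inj₁ refl)) =
  inj₂ (j , j-D , inj₂ (cong (λ n → F j ++ dotted (suc n) ∷ []) (sym (trans (sym (length-F j)) len))))
familyOrIdentity-appendMax F length-F D m .(F j ++ dotted (suc j) ∷ []) len cc (inj₂ (j , j-D , inj₂ refl)) =
  contradiction (2+m≡2+j , inj₂ refl , inj₂ refl) (proj₁ (cleanCompact-last (F j) (dotted (suc j)) _ cc))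
  where
  2+m≡2+j : 2 + m ≡ 2 + j
  2+m≡2+j = cong suc (trans (sym len) (trans (length-∷ʳ (F j) _) (cong suc (length-F j))))

vShaped-max-at-end : ∀ σ m → length σ ≡ 2 + m → IsPegPerm σ → VShaped σ →
                     valueAt σ 0 ≡ 2 + m ⊎ valueAt σ (suc m) ≡ 2 + m
vShaped-max-at-end σ m len π V with p , p<n , p-max ← valueAt-surjective σ π (2 + m) (s≤s z≤n) (≤-reflexive (sym len))
  with V p p<n
... | inj₁ left = inj₁ (at-front p p-max left)
  where
  at-front : ∀ p → valueAt σ p ≡ 2 + m → (∀ q → q < p → valueAt σ p < valueAt σ q) → valueAt σ 0 ≡ 2 + m
  at-front zero p-max _ = p-max
  at-front (suc p) p-max left = contradiction (at-most-max 0 (subst (0 <_) (sym len) (s≤s z≤n))) (<⇒≱ (left 0 (s≤s z≤n)))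
    where
    at-most-max : ∀ i → i < length σ → valueAt σ i ≤ valueAt σ (suc p)
    at-most-max i i<n = subst (valueAt σ i ≤_) (trans len (sym p-max)) (proj₂ (valueAt-bounds σ π i i<n))
... | inj₂ right with m<1+n⇒m<n∨m≡n (subst (p <_) len p<n)
...   | inj₂ refl = inj₂ p-max
...   | inj₁ p<m = contradiction (subst (valueAt σ (suc p) ≤_) (trans len (sym p-max)) (proj₂ (valueAt-bounds σ π (suc p) 1+p<n)))
                     (<⇒≱ (right (suc p) (n<1+n p) 1+p<n))
  where 1+p<n = subst (suc p <_) (sym len) (s≤s p<m)

-- A new maximum in front of Θ j would extend a decreasing strip (Θ j starts with its maximum, signed - or •),
-- so it wraps Θ j ++ [j + 1] into Θ (j + 2).
familyOrIdentity-Θ-consMax : ∀ D m τ → length τ ≡ suc m → CleanCompact (dotted (2 + m) ∷ τ) →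
  MarkedAtOne D (dotted (2 + m) ∷ τ) → FamilyOrIdentity Θ D τ → FamilyOrIdentity Θ D (dotted (2 + m) ∷ τ)
familyOrIdentity-Θ-consMax D m τ len cc M (inj₁ isId)
  with d , refl , d⁺ ← isIdentity-cleanCompact τ isId (cleanCompact-tail _ τ cc) (subst (1 ≤_) (sym len) (s≤s z≤n))
  with refl ← len | d | d⁺ | M 1 (s≤s (s≤s z≤n))
... | plus | _ | inj₂ (_ , plus≡D) = inj₂ (2 , plus≡D , inj₁ refl)
... | dot | _ | _ = contradiction (refl , inj₂ refl , inj₂ refl) (proj₁ (proj₂ cc))
... | minus | inj₁ () | _
... | minus | inj₂ () | _
familyOrIdentity-Θ-consMax D m .(Θ j) len cc M (inj₂ (j , j-D , inj₁ refl))
  with d , r , Θ≡ , d⁻ ← Θ-head m with refl ← trans (sym (length-Θ j)) len =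
  contradiction (refl , inj₂ refl , d⁻) (proj₁ (proj₂ (subst (λ w → CleanCompact (dotted (2 + m) ∷ w)) Θ≡ cc)))
familyOrIdentity-Θ-consMax D m .(Θ j ++ dotted (suc j) ∷ []) len cc M (inj₂ (j , j-D , inj₂ refl))
  with refl ← suc-injective (trans (sym (trans (length-∷ʳ (Θ j) _) (cong suc (length-Θ j)))) len) = wrap j j-D cc
  where
  wrap : ∀ j → parityDeco j ≡ D → CleanCompact (dotted (2 + j) ∷ Θ j ++ dotted (suc j) ∷ []) →
         FamilyOrIdentity Θ D (dotted (2 + j) ∷ Θ j ++ dotted (suc j) ∷ [])
  wrap zero _ cc = contradiction (refl , inj₂ refl , inj₂ refl) (proj₁ (proj₂ cc))
  wrap (suc j) j-D _ = inj₂ (3 + j , trans (parityDeco-2+ (suc j)) j-D , inj₁ refl)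

entryAt-last : ∀ τ x {n} → length τ ≡ n → entryAt (τ ++ x ∷ []) n ≡ x
entryAt-last τ x refl = entryAt-length τ x []

classify-vShaped-step : ∀ D m →
  (∀ τ → length τ ≡ suc m → IsPegPerm τ → VShaped τ → CleanCompact τ → MarkedAtOne D τ → FamilyOrIdentity Θ D τ) →
  ∀ σ → length σ ≡ 2 + m → IsPegPerm σ → VShaped σ → CleanCompact σ → MarkedAtOne D σ → FamilyOrIdentity Θ D σ
classify-vShaped-step D m classify σ len π V cc M with vShaped-max-at-end σ m len π V
classify-vShaped-step D m classify (x ∷ τ) len π V cc M | inj₁ refl with M 0 (s≤s z≤n)
... | inj₂ (() , _)
... | inj₁ refl = familyOrIdentity-Θ-consMax D m τ len′ cc M
      (classify τ len′ πτ (vShaped-embedding (tail-embedding x τ) V) (cleanCompact-tail x τ cc)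
        (markedAtOne-embedding (tail-embedding x τ) D πτ (valueAt-positive (x ∷ τ) π) M))
  where
  len′ = suc-injective len
  πτ = isPegPerm-tail x τ (cong suc (sym len′)) π
classify-vShaped-step D m classify σ len π V cc M | inj₂ last-max
  with τ , x , refl , len′ ← ∷ʳ-view σ (suc m) len
  with refl ← trans (sym (cong proj₁ (entryAt-last τ x len′))) last-max
  with M (suc m) (subst (suc m <_) (sym len) (n<1+n (suc m)))
... | inj₂ (last-one , _) = contradiction (trans (sym (cong proj₁ (entryAt-last τ x len′))) last-one) λ ()
... | inj₁ last-dot with refl ← trans (sym (cong proj₂ (entryAt-last τ x len′))) last-dot =
  familyOrIdentity-appendMax Θ length-Θ D m τ len′ cc
    (classify τ len′ πτ (vShaped-embedding (init-embedding τ x) V) (cleanCompact-init τ x cc)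
      (markedAtOne-embedding (init-embedding τ x) D πτ (valueAt-positive (τ ++ x ∷ []) π) M))
  where πτ = isPegPerm-init τ x (cong suc (sym len′)) π

classify-vShaped : ∀ D n σ → length σ ≡ n → IsPegPerm σ → VShaped σ → CleanCompact σ → MarkedAtOne D σ →
                   FamilyOrIdentity Θ D σ
classify-vShaped D zero [] _ _ _ _ _ = inj₁ (refl , [])
classify-vShaped D (suc zero) (x ∷ []) refl π _ _ M =
  familyOrIdentity-singleton Θ D refl x π (Data.Sum.map Function.id proj₂ (M 0 (s≤s z≤n)))
classify-vShaped D (suc (suc m)) = classify-vShaped-step D m (classify-vShaped D (suc m))

-- A new minimum after Λ j would extend a decreasing strip (Λ j ends with its minimum, signed - or •),
-- so it extends Λ j ++ [j + 1] into Λ (j + 2).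
familyOrIdentity-Λ-appendMin : ∀ D m τ → length τ ≡ suc m → CleanCompact (shift τ ++ dotted 1 ∷ []) →
  MarkedAtHead D (shift τ ++ dotted 1 ∷ []) → FamilyOrIdentity Λ D τ → FamilyOrIdentity Λ D (shift τ ++ dotted 1 ∷ [])
familyOrIdentity-Λ-appendMin D m τ len cc M (inj₁ isId)
  with d , refl , d⁺ ← isIdentity-cleanCompact τ isId (cleanCompact-unshift τ (cleanCompact-init (shift τ) _ cc))
                                                    (subst (1 ≤_) (sym len) (s≤s z≤n))
  with d | d⁺ | M 0 (s≤s z≤n)
... | plus | _ | inj₂ (_ , plus≡D) = inj₂ (2 , plus≡D , inj₁ refl)
... | dot | _ | _ = contradiction (refl , inj₂ refl , inj₂ refl) (proj₁ (proj₂ cc))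
... | minus | inj₁ () | _
... | minus | inj₂ () | _
familyOrIdentity-Λ-appendMin D m .(Λ j) len cc M (inj₂ (j , j-D , inj₁ refl))
  with refl ← trans (sym (length-Λ j)) len with d , l , Λ≡ , d⁻ ← Λ-last m =
  contradiction (refl , d⁻ , inj₂ refl) (proj₂ (cleanCompact-last (shift l) (2 , d) (dotted 1) (subst CleanCompact split cc)))
  where
  split : shift (Λ (suc m)) ++ dotted 1 ∷ [] ≡ (shift l ++ (2 , d) ∷ []) ++ dotted 1 ∷ []
  split = cong (_++ dotted 1 ∷ []) (trans (cong shift Λ≡) (map-++ shiftEntry l _))
familyOrIdentity-Λ-appendMin D m .(Λ j ++ dotted (suc j) ∷ []) len cc M (inj₂ (j , j-D , inj₂ refl)) =
  subst (FamilyOrIdentity Λ D) (sym (split j)) (extend j j-D (subst CleanCompact (split j) cc))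
  where
  split : ∀ j → shift (Λ j ++ dotted (suc j) ∷ []) ++ dotted 1 ∷ [] ≡ shift (Λ j) ++ dotted (2 + j) ∷ dotted 1 ∷ []
  split j = trans (cong (_++ dotted 1 ∷ []) (map-++ shiftEntry (Λ j) _)) (++-assoc (shift (Λ j)) _ _)
  extend : ∀ j → parityDeco j ≡ D → CleanCompact (shift (Λ j) ++ dotted (2 + j) ∷ dotted 1 ∷ []) →
           FamilyOrIdentity Λ D (shift (Λ j) ++ dotted (2 + j) ∷ dotted 1 ∷ [])
  extend zero _ cc = contradiction (refl , inj₂ refl , inj₂ refl) (proj₁ (proj₂ cc))
  extend (suc j) j-D _ = inj₂ (3 + j , trans (parityDeco-2+ (suc j)) j-D , inj₁ refl)

spiral-last-extreme : ∀ σ m → length σ ≡ 2 + m → IsPegPerm σ → Spiral σ →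
                      valueAt σ (suc m) ≡ 2 + m ⊎ valueAt σ (suc m) ≡ 1
spiral-last-extreme σ m len π S with S (suc m) last<n
  where last<n = subst (suc m <_) (sym len) (n<1+n _)
... | inj₁ max with r , r<n , r-max ← valueAt-surjective σ π (2 + m) (s≤s z≤n) (≤-reflexive (sym len))
  with m<1+n⇒m<n∨m≡n (subst (r <_) len r<n)
...   | inj₂ refl = inj₁ r-max
...   | inj₁ r<m = contradiction (subst (valueAt σ (suc m) ≤_) (trans len (sym r-max)) (proj₂ (valueAt-bounds σ π (suc m) last<n)))
                     (<⇒≱ (max r r<m))
  where last<n = subst (suc m <_) (sym len) (n<1+n _)
spiral-last-extreme σ m len π S | inj₂ min
  with r , r<n , r-min ← valueAt-surjective σ π 1 (s≤s z≤n) (subst (1 ≤_) (sym len) (s≤s z≤n))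
  with m<1+n⇒m<n∨m≡n (subst (r <_) len r<n)
...   | inj₂ refl = inj₂ r-min
...   | inj₁ r<m = contradiction (proj₁ (valueAt-bounds σ π (suc m) last<n)) (<⇒≱ (subst (valueAt σ (suc m) <_) r-min (min r r<m)))
  where last<n = subst (suc m <_) (sym len) (n<1+n _)

classify-spiral-step : ∀ D m →
  (∀ τ → length τ ≡ suc m → IsPegPerm τ → Spiral τ → CleanCompact τ → MarkedAtHead D τ → FamilyOrIdentity Λ D τ) →
  ∀ σ → length σ ≡ 2 + m → IsPegPerm σ → Spiral σ → CleanCompact σ → MarkedAtHead D σ → FamilyOrIdentity Λ D σ
classify-spiral-step D m classify σ len π S cc M
  with τ , x , refl , len′ ← ∷ʳ-view σ (suc m) len
  with M (suc m) (subst (suc m <_) (sym len) (n<1+n (suc m)))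
... | inj₂ (() , _)
... | inj₁ last-dot with refl ← trans (sym (cong proj₂ (entryAt-last τ x len′))) last-dot
  with spiral-last-extreme (τ ++ x ∷ []) m len π S
... | inj₁ last-max with refl ← trans (sym (cong proj₁ (entryAt-last τ x len′))) last-max =
  familyOrIdentity-appendMax Λ length-Λ D m τ len′ cc
    (classify τ len′ πτ (spiral-embedding (init-embedding τ x) S) (cleanCompact-init τ x cc)
      (markedAtHead-embedding (init-embedding τ x) D M))
  where πτ = isPegPerm-init τ x (cong suc (sym len′)) π
... | inj₂ last-min with refl ← trans (sym (cong proj₁ (entryAt-last τ x len′))) last-min
  with τ′ , refl , πτ′ ← isPegPerm-init-min τ x refl π =
  familyOrIdentity-Λ-appendMin D m τ′ len″ cc M
    (classify τ′ len″ πτ′ (spiral-embedding (shift-init-embedding τ′ x) S)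
      (cleanCompact-unshift τ′ (cleanCompact-init (shift τ′) x cc)) (markedAtHead-embedding (shift-init-embedding τ′ x) D M))
  where len″ = trans (sym (length-shift τ′)) len′

classify-spiral : ∀ D n σ → length σ ≡ n → IsPegPerm σ → Spiral σ → CleanCompact σ → MarkedAtHead D σ →
                  FamilyOrIdentity Λ D σ
classify-spiral D zero [] _ _ _ _ _ = inj₁ (refl , [])
classify-spiral D (suc zero) (x ∷ []) refl π _ _ M =
  familyOrIdentity-singleton Λ D refl x π (Data.Sum.map Function.id proj₂ (M 0 (s≤s z≤n)))
classify-spiral D (suc (suc m)) = classify-spiral-step D m (classify-spiral D (suc m))


record ExceptionalFamily (F : ℕ → Word) : Set where
  field
    length-F : ∀ m → length (F m) ≡ m
    isPegPerm-F : ∀ m → IsPegPerm (F m)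
    sortableWithin-F : ∀ m → SortableWithin m (F m)
    cleanCompact-F-top : ∀ m → CleanCompact (F (suc m) ++ (2 + m , plus) ∷ [])
    patterns-F : ∀ n σ → IsPegPerm σ → CleanCompact σ → IsPattern σ (F n) → FamilyOrIdentity F (parityDeco n) σ

Θ-exceptional : ExceptionalFamily Θ
Θ-exceptional = record
  { length-F = length-Θ
  ; isPegPerm-F = isPegPerm-Θ
  ; sortableWithin-F = sortableWithin-Θ
  ; cleanCompact-F-top = λ m → cleanCompact-Θ-top (suc m) plus
  ; patterns-F = λ n σ π cc pat → let E = isPattern⇒embedding σ (Θ n) pat in
      classify-vShaped (parityDeco n) (length σ) σ refl π (vShaped-embedding E (vShaped-Θ n)) cc
        (markedAtOne-embedding E (parityDeco n) π (valueAt-positive (Θ n) (isPegPerm-Θ n)) (markedAtOne-Θ n))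
  }

Λ-exceptional : ExceptionalFamily Λ
Λ-exceptional = record
  { length-F = length-Λ
  ; isPegPerm-F = isPegPerm-Λ
  ; sortableWithin-F = sortableWithin-Λ
  ; cleanCompact-F-top = λ m → cleanCompact-Λ-top m plus
  ; patterns-F = λ n σ π cc pat → let E = isPattern⇒embedding σ (Λ n) pat in
      classify-spiral (parityDeco n) (length σ) σ refl π (spiral-embedding E (spiral-Λ n)) cc
        (markedAtHead-embedding E (parityDeco n) (markedAtHead-Λ n))
  }

parityDeco-gap : ∀ j n → parityDeco j ≡ parityDeco n → j < n → suc j < n
parityDeco-gap j n same j<n with m<1+n⇒m<n∨m≡n (s≤s j<n)
... | inj₁ 1+j<n = 1+j<n
... | inj₂ refl = contradiction (sym same) (parityDeco-suc≢ j)

module _ {F : ℕ → Word} (𝓕 : ExceptionalFamily F) (k : ℕ) where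
  open ExceptionalFamily 𝓕

  private
    n = 2 + k

  n≤sortingBound : ∀ j → SortableWithin j (F n) → n ≤ j
  n≤sortingBound j s = subst (_≤ j) (length-F n)
    (length≤sortingBound (F n) (subst (λ l → CleanCompact (F n ++ (suc l , plus) ∷ [])) (sym (length-F n)) (cleanCompact-F-top (suc k))) s)

  prd-exceptional : PrdIs (F n) n
  prd-exceptional = sortableWithin-F n , λ j j<n s → <⇒≱ j<n (n≤sortingBound j s)

  -- A proper pattern F j of F n has the parity of n, so j ≤ n - 2 = k.
  proper-pattern-in-Bhat : ∀ σ → IsPegPerm σ → CleanCompact σ → IsPattern σ (F n) → σ ≢ F n → Bhat k σ
  proper-pattern-in-Bhat σ π cc pat σ≢ = π , sortable (patterns-F n σ π cc pat)
    where
    length≤n : length σ ≤ n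
    length≤n = subst (length σ ≤_) (length-F n) (embedding-length-≤ (isPattern⇒embedding σ (F n) pat))
    j≤k : ∀ j → parityDeco j ≡ parityDeco n → j < n → j ≤ k
    j≤k j same j<n = ≤-pred (≤-pred (parityDeco-gap j n same j<n))
    sortable : FamilyOrIdentity F (parityDeco n) σ → SortableWithin k σ
    sortable (inj₁ isId) = done isId
    sortable (inj₂ (j , same , inj₁ refl)) with m≤n⇒m<n∨m≡n (subst (_≤ n) (length-F j) length≤n)
    ... | inj₁ j<n = sortableWithin-mono (j≤k j same j<n) (sortableWithin-F j)
    ... | inj₂ refl = contradiction refl σ≢
    sortable (inj₂ (j , same , inj₂ refl)) =
      sortableWithin-mono (j≤k j same (subst (_≤ n) (trans (length-∷ʳ (F j) _) (cong suc (length-F j))) length≤n))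
        (subst (SortableWithin j) (cong (λ l → F j ++ dotted (suc l) ∷ []) (length-F j)) (sortableWithin-appendMax (F j) (sortableWithin-F j)))

  basis-prd-exceptional : InCleanCompactBasis (Bhat k) (F n) × PrdIs (F n) n
  basis-prd-exceptional = (isPegPerm-F n , cleanCompact-init (F n) _ (cleanCompact-F-top (suc k)) ,
                 (λ (_ , s) → 1+n≰n (≤-trans (n≤1+n (suc k)) (n≤sortingBound k s))) , proper-pattern-in-Bhat) ,
                prd-exceptional

mainTheorem6 : (k : ℕ) →
    ((k + 2) % 2 ≡ 0 →
      (InCleanCompactBasis (Bhat k) (Thetae (k + 2)) × PrdIs (Thetae (k + 2)) (k + 2)) ×
      (InCleanCompactBasis (Bhat k) (Lambdae (k + 2)) × PrdIs (Lambdae (k + 2)) (k + 2))) ×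
    ((k + 2) % 2 ≡ 1 →
      (InCleanCompactBasis (Bhat k) (Thetao (k + 2)) × PrdIs (Thetao (k + 2)) (k + 2)) ×
      (InCleanCompactBasis (Bhat k) (Lambdao (k + 2)) × PrdIs (Lambdao (k + 2)) (k + 2)))
mainTheorem6 k rewrite +-comm k 2 = even , odd
  where
  Holds : Word → Set
  Holds w = InCleanCompactBasis (Bhat k) w × PrdIs w (2 + k)
  even : (2 + k) % 2 ≡ 0 → Holds (Thetae (2 + k)) × Holds (Lambdae (2 + k))
  even _ with double-parity k
  even _ | inj₁ (j , refl) = subst Holds (sym (Thetae-Θ j)) (basis-prd-exceptional Θ-exceptional k) ,
                             subst Holds (sym (Lambdae-Λ j)) (basis-prd-exceptional Λ-exceptional k)
  even k%2≡0 | inj₂ (j , refl) = contradiction (trans (sym (1+double%2 (suc j))) k%2≡0) λ ()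
  odd : (2 + k) % 2 ≡ 1 → Holds (Thetao (2 + k)) × Holds (Lambdao (2 + k))
  odd _ with double-parity k
  odd _ | inj₂ (j , refl) = subst Holds (sym (Thetao-Θ j)) (basis-prd-exceptional Θ-exceptional k) ,
                            subst Holds (sym (Lambdao-Λ j)) (basis-prd-exceptional Λ-exceptional k)
  odd k%2≡1 | inj₁ (j , refl) = contradiction (trans (sym (double%2 (suc j))) k%2≡1) λ ()
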